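{- Let $k\in\mathbb{N}$. A graph $G=(V,E)$ is not $k$-equidominating if $G$ has two distinct pseudo classes each of size at least $k^2$, one of which is a stable set class.
   Context: All graphs are finite, simple and undirected; $\mathbb{N}=\{1,2,\dots\}$. An mds is an inclusion-minimal set $D\subseteq V$ such that every vertex is in $D$ or adjacent to a vertex of $D$. $G$ is $k$-equidominating if there exist $t\in\mathbb{N}$ and $w\colon V\to\{1,\dots,k\}$ such that for all $D\subseteq V$: $D$ is an mds iff $\sum_{v\in D}w(v)=t$. Twins: $v,w$ with $N(v)\setminus\{w\}=N(w)\setminus\{v\}$; twin classes are the equivalence classes; a singleton class has one vertex, a clique class at least two pairwise adjacent vertices, a stable set class at least two pairwise non-adjacent vertices. Two vertices $x,y$ are mds-exchangeable if some mds $D$ has $|\{x,y\}\cap D|=1$ and for every mds $D$ with $|\{x,y\}\cap D|=1$ the set $(D\setminus\{x,y\})\cup(\{x,y\}\setminus D)$ is an mds. A stable set bundle is an inclusion-maximal $\mathcal{S}\subseteq V$ with $G[\mathcal{S}]\cong K_{2n}-ne$ (complete graph on $2n$ vertices minus $n$ disjoint edges) for some $n\ge2$ such that all vertices of $\mathcal{S}$ have the same neighbors outside $\mathcal{S}$. A clique bundle is an inclusion-maximal clique of pairwise mds-exchangeable vertices containing vertices of at least two twin classes. A pseudo class is a stable set bundle, a clique bundle, or a twin class not contained in any bundle. -}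

module Defs where

open import Data.Nat using (ℕ; zero; suc; _+_; _*_; _≤_; _/_)
open import Data.Bool using (Bool; true; false; not; _∧_; if_then_else_)
open import Data.Fin using (Fin; toℕ)
open import Data.List using (map; allFin)
open import Data.Nat.ListAction using (sum)
open import Data.Product using (Σ; ∃; _×_; _,_)
open import Data.Sum using (_⊎_)
open import Relation.Nullary using (¬_; does)
open import Relation.Binary.PropositionalEquality using (_≡_; _≢_)
open import Function.Definitions using (Injective)
import Data.Nat as ℕ
import Data.Fin as F

record Graph (n : ℕ) : Set where
  field
    adj    : Fin n → Fin n → Bool
    sym    : ∀ u v → adj u v ≡ adj v u
    irrefl : ∀ v → adj v v ≡ false
open Graph public

VSet : ℕ → Set
VSet n = Fin n → Bool

_∈_ : ∀ {n} → Fin n → VSet n → Set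
v ∈ S = S v ≡ true

_∉_ : ∀ {n} → Fin n → VSet n → Set
v ∉ S = S v ≡ false

_⊆_ : ∀ {n} → VSet n → VSet n → Set
A ⊆ B = ∀ v → v ∈ A → v ∈ B

_≐_ : ∀ {n} → VSet n → VSet n → Set
A ≐ B = ∀ v → A v ≡ B v

Adj : ∀ {n} → Graph n → Fin n → Fin n → Set
Adj G u v = adj G u v ≡ true

card : ∀ {n} → VSet n → ℕ
card {n} S = sum (map (λ v → if S v then 1 else 0) (allFin n))

weight : ∀ {n} → (Fin n → ℕ) → VSet n → ℕ
weight {n} w D = sum (map (λ v → if D v then w v else 0) (allFin n))

Dominating : ∀ {n} → Graph n → VSet n → Set
Dominating G D = ∀ v → v ∈ D ⊎ (∃ λ u → u ∈ D × Adj G u v)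

IsMDS : ∀ {n} → Graph n → VSet n → Set
IsMDS G D = Dominating G D × (∀ D' → D' ⊆ D → Dominating G D' → D ⊆ D')

Equidominating : ∀ {n} → Graph n → ℕ → Set
Equidominating {n} G k =
  Σ ℕ λ t → 1 ≤ t × Σ (Fin n → ℕ) λ w →
    (∀ v → 1 ≤ w v × w v ≤ k) ×
    (∀ (D : VSet n) → (IsMDS G D → weight w D ≡ t) × (weight w D ≡ t → IsMDS G D))

Twins : ∀ {n} → Graph n → Fin n → Fin n → Set
Twins G v w = ∀ u → u ≢ v → u ≢ w → adj G v u ≡ adj G w u

TwinClass : ∀ {n} → Graph n → VSet n → Set
TwinClass G C = ∃ λ v → ∀ u → (u ∈ C → Twins G v u) × (Twins G v u → u ∈ C)

StableSetClass : ∀ {n} → Graph n → VSet n → Set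
StableSetClass G C =
  TwinClass G C × 2 ≤ card C × (∀ u v → u ∈ C → v ∈ C → adj G u v ≡ false)

_==_ : ∀ {n} → Fin n → Fin n → Bool
i == j = does (i F.≟ j)

swap : ∀ {n} → Fin n → Fin n → VSet n → VSet n
swap x y D v = if (v == x) Data.Bool.∨ (v == y) then not (D v) else D v
  where import Data.Bool

ExactlyOne : ∀ {n} → Fin n → Fin n → VSet n → Set
ExactlyOne x y D = (x ∈ D × y ∉ D) ⊎ (x ∉ D × y ∈ D)

MdsExchangeable : ∀ {n} → Graph n → Fin n → Fin n → Set
MdsExchangeable G x y =
  (∃ λ D → IsMDS G D × ExactlyOne x y D) ×
  (∀ D → IsMDS G D → ExactlyOne x y D → IsMDS G (swap x y D))

-- the model graph K_{2m} − m e on Fin (2 * m): i, j adjacent iff i ≠ j and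
-- they are not matched, where the removed perfect matching is {2l, 2l+1}.
KminusMatching : (m : ℕ) → Fin (2 * m) → Fin (2 * m) → Bool
KminusMatching m i j = not (i == j) ∧ not (does ((toℕ i / 2) ℕ.≟ (toℕ j / 2)))

-- G[S] ≅ K_{2m} − m e for some m ≥ 2
InducesKminusMatching : ∀ {n} → Graph n → VSet n → Set
InducesKminusMatching {n} G S =
  Σ ℕ λ m → 2 ≤ m × Σ (Fin (2 * m) → Fin n) λ f →
    Injective _≡_ _≡_ f ×
    (∀ i → f i ∈ S) × (∀ v → v ∈ S → ∃ λ i → f i ≡ v) ×
    (∀ i j → adj G (f i) (f j) ≡ KminusMatching m i j)

SameOutsideNeighbours : ∀ {n} → Graph n → VSet n → Set
SameOutsideNeighbours G S =
  ∀ u v x → u ∈ S → v ∈ S → x ∉ S → adj G u x ≡ adj G v x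

StableBundleCandidate : ∀ {n} → Graph n → VSet n → Set
StableBundleCandidate G S = InducesKminusMatching G S × SameOutsideNeighbours G S

StableSetBundle : ∀ {n} → Graph n → VSet n → Set
StableSetBundle G S =
  StableBundleCandidate G S × (∀ S' → S ⊆ S' → StableBundleCandidate G S' → S' ⊆ S)

ExchangeableClique : ∀ {n} → Graph n → VSet n → Set
ExchangeableClique G C =
  ∀ u v → u ∈ C → v ∈ C → u ≢ v → Adj G u v × MdsExchangeable G u v

MeetsTwoTwinClasses : ∀ {n} → Graph n → VSet n → Set
MeetsTwoTwinClasses G C = ∃ λ u → ∃ λ v → u ∈ C × v ∈ C × ¬ Twins G u v

CliqueBundleCandidate : ∀ {n} → Graph n → VSet n → Set
CliqueBundleCandidate G C = ExchangeableClique G C × MeetsTwoTwinClasses G C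

CliqueBundle : ∀ {n} → Graph n → VSet n → Set
CliqueBundle G C =
  CliqueBundleCandidate G C × (∀ C' → C ⊆ C' → CliqueBundleCandidate G C' → C' ⊆ C)

Bundle : ∀ {n} → Graph n → VSet n → Set
Bundle G B = StableSetBundle G B ⊎ CliqueBundle G B

PseudoClass : ∀ {n} → Graph n → VSet n → Set
PseudoClass G P =
  StableSetBundle G P ⊎ CliqueBundle G P ⊎
  (TwinClass G P × (∀ B → Bundle G B → ¬ (P ⊆ B)))

module Submission where

-- Let w : V → [1,k] and t witness k-equidominance: the mds are exactly the sets
-- of weight t.  By the exchange lemma (pigeonhole on prefix sums) two sets of at
-- least k vertices contain subsets X, Y of equal weight, X nonempty, |X| ≤ k.  So
-- if an mds D ⊇ P leaves k vertices outside, S = (D ∖ X) ∪ Y with X ⊆ P is an mds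
-- missing a vertex of P; that is impossible if |P ∖ X| ≥ 2 (a vertex of P becomes
-- redundant) or if P is isolated.  Such D are greedy maximal independent sets:
-- if P has a neighbour x, compare D ⊇ P with an mds E ∋ x, giving k² ≤ w(E ∖ D);
-- if P is isolated, Q has a hub z and D ⊇ P ∪ {z}.  In the remaining case k = 1,
-- |P| = 2, the mds are exactly the pairs, so G ≅ K_{2m} − m e is a stable set
-- bundle containing P, contradicting that P is a pseudo class.

open import Defs
open import Data.Nat as ℕ
  using (ℕ; zero; suc; _+_; _*_; _∸_; _≤_; _<_; z≤n; s≤s; _≤?_; _<?_; _/_)
open import Data.Nat.Properties
open import Data.Nat.DivMod using (m/n≡0⇒m<n; m<n⇒m/n≡0; m*n/n≡m; +-distrib-/-∣ˡ; m<n*o⇒m/o<n)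
open import Data.Nat.Divisibility using (m∣m*n)
import Data.Nat.ListAction as ListSum
open import Algebra.Properties.Semiring.Sum +-*-semiring
  using (sum; ∑-distrib-+; sum-cong-≗; sum-replicate-zero; *-distribˡ-sum)
open import Data.Bool using (Bool; true; false; not; _∧_; _∨_; if_then_else_)
import Data.Bool.Properties as BoolP
open import Data.Fin as F using (Fin; toℕ)
import Data.Fin.Properties as FinP
open import Data.List using (List; []; _∷_; allFin; tabulate; filter; lookup; length)
open import Data.List.Properties using (map-tabulate)
import Data.List.Relation.Unary.All as All
open import Data.List.Relation.Unary.Any using (here; there)
import Data.List.Relation.Unary.Any as Any
open import Data.List.Relation.Unary.Any.Properties using (lookup-index)
open import Data.List.Relation.Unary.Unique.Propositional using (Unique; _∷_)
import Data.List.Relation.Unary.Unique.Propositional.Properties as Unique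
open import Data.List.Membership.Propositional using () renaming (_∈_ to _List∈_)
open import Data.List.Membership.Propositional.Properties
  using (∈-allFin; ∈-filter⁺; ∈-filter⁻; ∈-lookup)
open import Data.Product using (Σ; ∃; ∃₂; _×_; _,_; proj₁; proj₂; uncurry)
open import Data.Sum using (_⊎_; inj₁; inj₂)
open import Data.Empty using (⊥; ⊥-elim)
open import Function using (id; _∘_)
open import Function.Definitions using (Injective)
open import Relation.Nullary using (¬_; Dec; yes; no; does)
open import Relation.Nullary.Decidable using (dec-true; dec-false)
open import Relation.Binary.PropositionalEquality
  using (_≡_; _≢_; refl; trans; cong; cong₂; subst; subst₂; module ≡-Reasoning)
  renaming (sym to ≡-sym)

true≢false : true ≢ false
true≢false ()

∧-true-l : ∀ a {b} → (a ∧ b) ≡ true → a ≡ true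
∧-true-l a {b} = BoolP.∧-conicalˡ a b

∧-true-r : ∀ a {b} → (a ∧ b) ≡ true → b ≡ true
∧-true-r a {b} = BoolP.∧-conicalʳ a b

∧-not-r : ∀ a {b} → (a ∧ not b) ≡ true → b ≡ false
∧-not-r true {false} _ = refl

≢true : ∀ {b} → ¬ (b ≡ true) → b ≡ false
≢true {false} _ = refl
≢true {true} h = ⊥-elim (h refl)

≢false : ∀ {b} → ¬ (b ≡ false) → b ≡ true
≢false {true} _ = refl
≢false {false} h = ⊥-elim (h refl)

==-refl : ∀ {n} (i : Fin n) → (i == i) ≡ true
==-refl i = dec-true (i FinP.≟ i) refl

≢⇒==-false : ∀ {n} {i j : Fin n} → i ≢ j → (i == j) ≡ false
≢⇒==-false {i = i} {j} = dec-false (i FinP.≟ j)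

==-false⇒≢ : ∀ {n} {i j : Fin n} → (i == j) ≡ false → i ≢ j
==-false⇒≢ {i = i} h refl = true≢false (trans (≡-sym (==-refl i)) h)

∅ : ∀ {n} → VSet n
∅ _ = false

⟦_⟧ : ∀ {n} → Fin n → VSet n
⟦ z ⟧ v = v == z

_∪_ : ∀ {n} → VSet n → VSet n → VSet n
(A ∪ B) v = A v ∨ B v

_∩_ : ∀ {n} → VSet n → VSet n → VSet n
(A ∩ B) v = A v ∧ B v

_∖_ : ∀ {n} → VSet n → VSet n → VSet n
(A ∖ B) v = A v ∧ not (B v)

∁ : ∀ {n} → VSet n → VSet n
∁ A v = not (A v)

infixl 26 _∪_ _∖_
infixl 27 _∩_

Disjoint : ∀ {n} → VSet n → VSet n → Set
Disjoint A B = ∀ v → v ∈ A → v ∉ B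

⊆-antisym : ∀ {n} {A B : VSet n} → A ⊆ B → B ⊆ A → A ≐ B
⊆-antisym {A = A} {B} A⊆B B⊆A v with A v in eA | B v in eB
... | true | true = refl
... | false | false = refl
... | true | false = ⊥-elim (true≢false (trans (≡-sym (A⊆B v eA)) eB))
... | false | true = ⊥-elim (true≢false (trans (≡-sym (B⊆A v eB)) eA))

∈⟦⟧ : ∀ {n} {u v : Fin n} → u ∈ ⟦ v ⟧ → u ≡ v
∈⟦⟧ {u = u} {v} h with u FinP.≟ v
... | yes u≡v = u≡v

∈∁ : ∀ {n} {A : VSet n} {v} → v ∉ A → v ∈ ∁ A
∈∁ h = cong not h

∁-disjoint : ∀ {n} (A : VSet n) → Disjoint (∁ A) A
∁-disjoint A v h with A v
... | false = refl

∈∖ : ∀ {n} {A B : VSet n} {v} → v ∈ A → v ∉ B → v ∈ A ∖ B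
∈∖ vA vB rewrite vA | vB = refl

∖-∈ : ∀ {n} {A B : VSet n} {v} → v ∈ A ∖ B → v ∈ A × v ∉ B
∖-∈ {A = A} {v = v} h = ∧-true-l (A v) h , ∧-not-r (A v) h

∈∪ˡ : ∀ {n} {A B : VSet n} {v} → v ∈ A → v ∈ A ∪ B
∈∪ˡ h rewrite h = refl

∈∪ʳ : ∀ {n} {A B : VSet n} {v} → v ∈ B → v ∈ A ∪ B
∈∪ʳ {A = A} {v = v} h rewrite h = BoolP.∨-zeroʳ (A v)

∪-∈ : ∀ {n} {A B : VSet n} {v} → v ∈ A ∪ B → v ∈ A ⊎ v ∈ B
∪-∈ {A = A} {v = v} h with A v
... | true = inj₁ refl
... | false = inj₂ h

∪⟦⟧-∈ : ∀ {n} {A : VSet n} {z v} → v ∈ A ∪ ⟦ z ⟧ → v ∈ A ⊎ v ≡ z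
∪⟦⟧-∈ {A = A} {z} {v} h with ∪-∈ {A = A} {B = ⟦ z ⟧} h
... | inj₁ v∈A = inj₁ v∈A
... | inj₂ v∈z = inj₂ (∈⟦⟧ v∈z)

∉-exchanged : ∀ {n} {D X Y : VSet n} {v} → v ∈ X → v ∉ Y → v ∉ D ∖ X ∪ Y
∉-exchanged {D = D} {v = v} v∈X v∉Y rewrite v∈X | v∉Y =
  trans (BoolP.∨-identityʳ (D v ∧ false)) (BoolP.∧-zeroʳ (D v))

-- Weights of vertex sets.  W w A is the w-weight of A written as a sum over
-- Fin n, which agrees with the list sums used by weight and card.

restrict : ∀ {n} → (Fin n → ℕ) → VSet n → Fin n → ℕ
restrict w A v = if A v then w v else 0

W : ∀ {n} → (Fin n → ℕ) → VSet n → ℕ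
W w A = sum (restrict w A)

∣_∣ : ∀ {n} → VSet n → ℕ
∣ A ∣ = W (λ _ → 1) A

sum-tabulate : ∀ {n} (f : Fin n → ℕ) → ListSum.sum (tabulate f) ≡ sum f
sum-tabulate {zero} f = refl
sum-tabulate {suc n} f = cong (f F.zero +_) (sum-tabulate (f ∘ F.suc))

weight≡W : ∀ {n} (w : Fin n → ℕ) (A : VSet n) → weight w A ≡ W w A
weight≡W w A =
  trans (cong ListSum.sum (map-tabulate id (restrict w A))) (sum-tabulate (restrict w A))

card≡∣∣ : ∀ {n} (A : VSet n) → card A ≡ ∣ A ∣
card≡∣∣ = weight≡W (λ _ → 1)

sum-mono : ∀ {n} {f g : Fin n → ℕ} → (∀ v → f v ≤ g v) → sum f ≤ sum g
sum-mono {zero} h = z≤n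
sum-mono {suc n} h = +-mono-≤ (h F.zero) (sum-mono (h ∘ F.suc))

sum-positive : ∀ {n} (f : Fin n → ℕ) → 1 ≤ sum f → ∃ λ v → 1 ≤ f v
sum-positive {suc n} f h with f F.zero in eq
... | suc _ = F.zero , subst (1 ≤_) (≡-sym eq) (s≤s z≤n)
... | zero = let (v , p) = sum-positive (f ∘ F.suc) h in F.suc v , p

sum-point : ∀ {n} (z : Fin n) (f : Fin n → ℕ) → (∀ v → v ≢ z → f v ≡ 0) → sum f ≡ f z
sum-point {suc n} F.zero f h =
  trans (cong (f F.zero +_) (trans (sum-cong-≗ (λ v → h (F.suc v) λ ())) (sum-replicate-zero n)))
        (+-identityʳ _)
sum-point {suc n} (F.suc z) f h =
  trans (cong (_+ sum (f ∘ F.suc)) (h F.zero λ ()))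
        (sum-point z (f ∘ F.suc) (λ v ne → h (F.suc v) (ne ∘ FinP.suc-injective)))

module _ {n : ℕ} (w : Fin n → ℕ) where

  W-cong : ∀ {A B : VSet n} → A ≐ B → W w A ≡ W w B
  W-cong A≐B = sum-cong-≗ (λ v → cong (λ b → if b then w v else 0) (A≐B v))

  W-mono : ∀ {A B : VSet n} → A ⊆ B → W w A ≤ W w B
  W-mono {A} {B} A⊆B = sum-mono pointwise
    where
    pointwise : ∀ v → restrict w A v ≤ restrict w B v
    pointwise v with A v in eq
    ... | false = z≤n
    ... | true rewrite A⊆B v eq = ≤-refl

  W-split : ∀ (A B : VSet n) → W w A ≡ W w (A ∩ B) + W w (A ∖ B)
  W-split A B = trans (sum-cong-≗ pointwise) (∑-distrib-+ (restrict w (A ∩ B)) (restrict w (A ∖ B)))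
    where
    pointwise : ∀ v → restrict w A v ≡ restrict w (A ∩ B) v + restrict w (A ∖ B) v
    pointwise v with A v | B v
    ... | true | true = ≡-sym (+-identityʳ _)
    ... | true | false = refl
    ... | false | _ = refl

  W-∪ : ∀ (A B : VSet n) → Disjoint A B → W w (A ∪ B) ≡ W w A + W w B
  W-∪ A B disj = trans (sum-cong-≗ pointwise) (∑-distrib-+ (restrict w A) (restrict w B))
    where
    pointwise : ∀ v → restrict w (A ∪ B) v ≡ restrict w A v + restrict w B v
    pointwise v with A v in eA | B v in eB
    ... | true | true = ⊥-elim (true≢false (trans (≡-sym eB) (disj v eA)))
    ... | true | false = ≡-sym (+-identityʳ _)
    ... | false | _ = refl

  W-⟦⟧ : ∀ z → W w ⟦ z ⟧ ≡ w z
  W-⟦⟧ z = trans (sum-point z (restrict w ⟦ z ⟧) outside) (cong (λ b → if b then w z else 0) (==-refl z))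
    where
    outside : ∀ v → v ≢ z → restrict w ⟦ z ⟧ v ≡ 0
    outside v v≢z rewrite ≢⇒==-false v≢z = refl

  W-∅ : W w ∅ ≡ 0
  W-∅ = sum-replicate-zero n

  W-exchange : ∀ (D X Y : VSet n) → X ⊆ D → Disjoint Y D →
               W w (D ∖ X ∪ Y) + W w X ≡ W w D + W w Y
  W-exchange D X Y X⊆D disj =
    trans (≡-sym (∑-distrib-+ (restrict w (D ∖ X ∪ Y)) (restrict w X)))
          (trans (sum-cong-≗ pointwise) (∑-distrib-+ (restrict w D) (restrict w Y)))
    where
    pointwise : ∀ v → restrict w (D ∖ X ∪ Y) v + restrict w X v ≡ restrict w D v + restrict w Y v
    pointwise v with D v in eD | X v in eX | Y v in eY
    ... | true | _ | true = ⊥-elim (true≢false (trans (≡-sym eD) (disj v eY)))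
    ... | true | true | false = ≡-sym (+-identityʳ _)
    ... | true | false | false = refl
    ... | false | true | _ = ⊥-elim (true≢false (trans (≡-sym (X⊆D v eX)) eD))
    ... | false | false | true = +-comm _ 0
    ... | false | false | false = refl

  ∣∣≤W : (∀ v → 1 ≤ w v) → ∀ A → ∣ A ∣ ≤ W w A
  ∣∣≤W w≥1 A = sum-mono pointwise
    where
    pointwise : ∀ v → restrict (λ _ → 1) A v ≤ restrict w A v
    pointwise v with A v
    ... | true = w≥1 v
    ... | false = z≤n

  W≤k*∣∣ : ∀ k → (∀ v → w v ≤ k) → ∀ A → W w A ≤ k * ∣ A ∣
  W≤k*∣∣ k w≤k A =
    subst (W w A ≤_) (≡-sym (*-distribˡ-sum k (restrict (λ _ → 1) A))) (sum-mono pointwise)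
    where
    pointwise : ∀ v → restrict w A v ≤ k * restrict (λ _ → 1) A v
    pointwise v with A v
    ... | true = subst (w v ≤_) (≡-sym (*-identityʳ k)) (w≤k v)
    ... | false = z≤n

  W-unit : (∀ v → w v ≡ 1) → ∀ A → W w A ≡ ∣ A ∣
  W-unit w≡1 A = sum-cong-≗ pointwise
    where
    pointwise : ∀ v → restrict w A v ≡ restrict (λ _ → 1) A v
    pointwise v with A v
    ... | true = w≡1 v
    ... | false = refl

nonempty : ∀ {n} (A : VSet n) → 1 ≤ ∣ A ∣ → ∃ λ v → v ∈ A
nonempty A h with sum-positive (restrict (λ _ → 1) A) h
... | v , p with A v in eq
... | true = v , eq

∣∣-⟦⟧ : ∀ {n} (z : Fin n) → ∣ ⟦ z ⟧ ∣ ≡ 1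
∣∣-⟦⟧ = W-⟦⟧ (λ _ → 1)

∣∣-∖ : ∀ {n} (A X : VSet n) → ∣ A ∣ ≤ ∣ A ∖ X ∣ + ∣ X ∣
∣∣-∖ A X = begin
  ∣ A ∣                     ≡⟨ W-split _ A X ⟩
  ∣ A ∩ X ∣ + ∣ A ∖ X ∣     ≤⟨ +-monoˡ-≤ _ (W-mono _ (λ v → ∧-true-r (A v))) ⟩
  ∣ X ∣ + ∣ A ∖ X ∣         ≡⟨ +-comm ∣ X ∣ _ ⟩
  ∣ A ∖ X ∣ + ∣ X ∣         ∎
  where open ≤-Reasoning

∣∣-∖-≥ : ∀ {n} (A X : VSet n) k m → k + m ≤ ∣ A ∣ → ∣ X ∣ ≤ k → m ≤ ∣ A ∖ X ∣
∣∣-∖-≥ A X k m k+m≤∣A∣ ∣X∣≤k = +-cancelʳ-≤ k m _ (begin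
  m + k              ≡⟨ +-comm m k ⟩
  k + m              ≤⟨ k+m≤∣A∣ ⟩
  ∣ A ∣              ≤⟨ ∣∣-∖ A X ⟩
  ∣ A ∖ X ∣ + ∣ X ∣  ≤⟨ +-monoʳ-≤ _ ∣X∣≤k ⟩
  ∣ A ∖ X ∣ + k      ∎)
  where open ≤-Reasoning

∣∣-remove : ∀ {n} (A : VSet n) (z : Fin n) → ∣ A ∣ ≤ ∣ A ∖ ⟦ z ⟧ ∣ + 1
∣∣-remove A z = subst (λ m → ∣ A ∣ ≤ ∣ A ∖ ⟦ z ⟧ ∣ + m) (∣∣-⟦⟧ z) (∣∣-∖ A ⟦ z ⟧)

two-elements : ∀ {n} (A : VSet n) → 2 ≤ ∣ A ∣ → ∃₂ λ u v → u ∈ A × v ∈ A × u ≢ v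
two-elements {n} A h with nonempty A (≤-trans (s≤s z≤n) h)
... | z , z∈A with nonempty (A ∖ ⟦ z ⟧) (+-cancelʳ-≤ 1 1 _ (≤-trans h (∣∣-remove A z)))
... | u , u∈A∖z = u , z , proj₁ (∖-∈ {A = A} {B = ⟦ z ⟧} u∈A∖z) , z∈A , ==-false⇒≢ {n} {u} {z} (proj₂ (∖-∈ {A = A} {B = ⟦ z ⟧} u∈A∖z))

-- Maximal independent sets.  An independent dominating set is an mds, and a
-- greedy pass over all vertices extends any independent set to one.

module _ {n : ℕ} (G : Graph n) where

  Independent : VSet n → Set
  Independent I = ∀ u v → u ∈ I → v ∈ I → adj G u v ≡ false

  DominatedBy : VSet n → Fin n → Set
  DominatedBy I v = v ∈ I ⊎ ∃ λ u → u ∈ I × Adj G u v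

  -- every vertex of an independent set I is dominated only by itself, so no
  -- proper subset of I dominates
  independent-dominating⇒mds : ∀ D → Independent D → Dominating G D → IsMDS G D
  independent-dominating⇒mds D indep dom = dom , λ D' D'⊆D dom' v v∈D → kept D' v v∈D D'⊆D (dom' v)
    where
    kept : ∀ D' v → v ∈ D → D' ⊆ D → DominatedBy D' v → v ∈ D'
    kept D' v v∈D D'⊆D (inj₁ v∈D') = v∈D'
    kept D' v v∈D D'⊆D (inj₂ (u , u∈D' , u~v)) =
      ⊥-elim (true≢false (trans (≡-sym u~v) (indep u v (D'⊆D u u∈D') v∈D)))

  hasNeighbourIn : VSet n → Fin n → Bool
  hasNeighbourIn I v = does (FinP.any? (λ u → (I u ∧ adj G u v) BoolP.≟ true))

  hasNeighbourIn-true : ∀ I v → hasNeighbourIn I v ≡ true → ∃ λ u → u ∈ I × Adj G u v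
  hasNeighbourIn-true I v h with FinP.any? (λ u → (I u ∧ adj G u v) BoolP.≟ true)
  ... | yes (u , p) = u , ∧-true-l (I u) p , ∧-true-r (I u) p

  hasNeighbourIn-false : ∀ I v → hasNeighbourIn I v ≡ false → ∀ u → u ∈ I → adj G u v ≡ false
  hasNeighbourIn-false I v h u u∈I with FinP.any? (λ u → (I u ∧ adj G u v) BoolP.≟ true)
  ... | no none = ≢true λ u~v → none (u , subst (λ b → (b ∧ adj G u v) ≡ true) (≡-sym u∈I) u~v)

  greedyStep : VSet n → Fin n → VSet n
  greedyStep I v = if hasNeighbourIn I v then I else I ∪ ⟦ v ⟧

  greedy : List (Fin n) → VSet n → VSet n
  greedy [] I = I
  greedy (v ∷ vs) I = greedy vs (greedyStep I v)

  greedyStep-⊇ : ∀ I v → I ⊆ greedyStep I v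
  greedyStep-⊇ I v u u∈I with hasNeighbourIn I v
  ... | true = u∈I
  ... | false = ∈∪ˡ {A = I} {B = ⟦ v ⟧} u∈I

  greedyStep-independent : ∀ I v → Independent I → Independent (greedyStep I v)
  greedyStep-independent I v indep with hasNeighbourIn I v in eq
  ... | true = indep
  ... | false = λ a b a∈ b∈ → cases a b (∪⟦⟧-∈ {A = I} a∈) (∪⟦⟧-∈ {A = I} b∈)
    where
    cases : ∀ a b → a ∈ I ⊎ a ≡ v → b ∈ I ⊎ b ≡ v → adj G a b ≡ false
    cases a b (inj₁ a∈I) (inj₁ b∈I) = indep a b a∈I b∈I
    cases a _ (inj₁ a∈I) (inj₂ refl) = hasNeighbourIn-false I v eq a a∈I
    cases _ b (inj₂ refl) (inj₁ b∈I) = trans (sym G v b) (hasNeighbourIn-false I v eq b b∈I)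
    cases _ _ (inj₂ refl) (inj₂ refl) = irrefl G v

  greedyStep-dominates : ∀ I v → DominatedBy (greedyStep I v) v
  greedyStep-dominates I v with hasNeighbourIn I v in eq
  ... | true = inj₂ (hasNeighbourIn-true I v eq)
  ... | false = inj₁ (∈∪ʳ {A = I} {B = ⟦ v ⟧} (==-refl v))

  greedy-⊇ : ∀ vs I → I ⊆ greedy vs I
  greedy-⊇ [] I u h = h
  greedy-⊇ (v ∷ vs) I u h = greedy-⊇ vs (greedyStep I v) u (greedyStep-⊇ I v u h)

  greedy-independent : ∀ vs I → Independent I → Independent (greedy vs I)
  greedy-independent [] I h = h
  greedy-independent (v ∷ vs) I h = greedy-independent vs (greedyStep I v) (greedyStep-independent I v h)

  -- once dominated, a vertex stays dominated since the set only grows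
  greedy-dominates : ∀ vs I v → v List∈ vs → DominatedBy (greedy vs I) v
  greedy-dominates (_ ∷ vs) I v (here refl) = grow (greedyStep-dominates I v)
    where
    grow : DominatedBy (greedyStep I v) v → DominatedBy (greedy vs (greedyStep I v)) v
    grow (inj₁ v∈) = inj₁ (greedy-⊇ vs _ v v∈)
    grow (inj₂ (u , u∈ , u~v)) = inj₂ (u , greedy-⊇ vs _ u u∈ , u~v)
  greedy-dominates (x ∷ vs) I v (there p) = greedy-dominates vs (greedyStep I x) v p

  mis : VSet n → VSet n
  mis I = greedy (allFin n) I

  mis-⊇ : ∀ I → I ⊆ mis I
  mis-⊇ = greedy-⊇ (allFin n)

  mis-independent : ∀ I → Independent I → Independent (mis I)
  mis-independent = greedy-independent (allFin n)

  mis-mds : ∀ I → Independent I → IsMDS G (mis I)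
  mis-mds I indep = independent-dominating⇒mds (mis I) (mis-independent I indep)
    (λ v → greedy-dominates (allFin n) I v (∈-allFin v))

-- Equal blocks.  Assuming X k ≤ Y k, let j(i) be the last index
-- with Y j(i) ≤ X i; the k+1 overshoots X i ∸ Y j(i) (i ≤ k) all lie below k,
-- so two of them coincide by pigeonhole, and that gives the two blocks.

StepSeq : ℕ → (ℕ → ℕ) → Set
StepSeq k X = X 0 ≡ 0 × (∀ i → i < k → X i < X (suc i) × X (suc i) ≤ X i + k)

EqualBlocks : ℕ → (ℕ → ℕ) → (ℕ → ℕ) → Set
EqualBlocks k X Y = ∃₂ λ i i' → ∃₂ λ j j' →
  i < i' × i' ≤ k × j < j' × j' ≤ k × X i' + Y j ≡ Y j' + X i

module _ {k : ℕ} {X : ℕ → ℕ} (sX : StepSeq k X) where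

  step-< : ∀ i j → i < j → j ≤ k → X i < X j
  step-< i (suc j) (s≤s i≤j) j<k with m≤n⇒m<n∨m≡n i≤j
  ... | inj₂ refl = proj₁ (proj₂ sX i j<k)
  ... | inj₁ i<j = <-trans (step-< i j i<j (<⇒≤ j<k)) (proj₁ (proj₂ sX j j<k))

  step-≤ : ∀ i j → i ≤ j → j ≤ k → X i ≤ X j
  step-≤ i j i≤j j≤k with m≤n⇒m<n∨m≡n i≤j
  ... | inj₂ refl = ≤-refl
  ... | inj₁ i<j = <⇒≤ (step-< i j i<j j≤k)

EqualBlocks-sym : ∀ {k} {X Y : ℕ → ℕ} → EqualBlocks k Y X → EqualBlocks k X Y
EqualBlocks-sym (i , i' , j , j' , i<i' , i'≤k , j<j' , j'≤k , eq) =
  j , j' , i , i' , j<j' , j'≤k , i<i' , i'≤k , ≡-sym eq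

module EqualBlocksBelow (k : ℕ) .{{_ : ℕ.NonZero k}} (X Y : ℕ → ℕ)
  (sX : StepSeq k X) (sY : StepSeq k Y) (Xk≤Yk : X k ≤ Y k) where

  lastBelow : ℕ → ℕ → ℕ
  lastBelow zero x = 0
  lastBelow (suc c) x with Y (suc c) ≤? x
  ... | yes _ = suc c
  ... | no _ = lastBelow c x

  lastBelow-below : ∀ c x → Y (lastBelow c x) ≤ x
  lastBelow-below zero x rewrite proj₁ sY = z≤n
  lastBelow-below (suc c) x with Y (suc c) ≤? x
  ... | yes p = p
  ... | no _ = lastBelow-below c x

  lastBelow-≤ : ∀ c x → lastBelow c x ≤ c
  lastBelow-≤ zero x = z≤n
  lastBelow-≤ (suc c) x with Y (suc c) ≤? x
  ... | yes _ = ≤-refl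
  ... | no _ = m≤n⇒m≤1+n (lastBelow-≤ c x)

  lastBelow-last : ∀ c x j → lastBelow c x < j → j ≤ c → x < Y j
  lastBelow-last zero x zero () z≤n
  lastBelow-last (suc c) x j p q with Y (suc c) ≤? x
  ... | yes _ = ⊥-elim (<-irrefl refl (≤-trans p q))
  ... | no Ysc≰x with m≤n⇒m<n∨m≡n q
  ... | inj₂ refl = ≰⇒> Ysc≰x
  ... | inj₁ j<sc = lastBelow-last c x j p (≤-pred j<sc)

  match : ℕ → ℕ
  match i = lastBelow k (X i)

  overshoot : ℕ → ℕ
  overshoot i = X i ∸ Y (match i)

  X≡overshoot+Y : ∀ i → X i ≡ overshoot i + Y (match i)
  X≡overshoot+Y i = ≡-sym (m∸n+n≡m (lastBelow-below k (X i)))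

  overshoot<k : ∀ i → i ≤ k → overshoot i < k
  overshoot<k i i≤k with m≤n⇒m<n∨m≡n (lastBelow-≤ k (X i))
  ... | inj₁ match<k = m<n+o⇒m∸n<o (X i) (Y (match i))
        (<-≤-trans (lastBelow-last k (X i) (suc (match i)) ≤-refl match<k)
                   (proj₂ (proj₂ sY (match i) match<k)))
  ... | inj₂ match≡k = subst (_< k) (≡-sym (m≤n⇒m∸n≡0 Xi≤Ymatch)) (ℕ.>-nonZero⁻¹ k)
    where
    Xi≤Ymatch : X i ≤ Y (match i)
    Xi≤Ymatch = subst (λ j → X i ≤ Y j) (≡-sym match≡k) (≤-trans (step-≤ sX i k i≤k ≤-refl) Xk≤Yk)

  overshootFin : Fin (suc k) → Fin k
  overshootFin i = F.fromℕ< (overshoot<k (toℕ i) (≤-pred (FinP.toℕ<n i)))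

  equal-blocks-below : EqualBlocks k X Y
  equal-blocks-below with FinP.pigeonhole (n<1+n k) overshootFin
  ... | i , i' , i<i' , same = a , b , match a , match b , i<i' , b≤k , match< , lastBelow-≤ k (X b) , blocks
    where
    a b : ℕ
    a = toℕ i
    b = toℕ i'
    b≤k : b ≤ k
    b≤k = ≤-pred (FinP.toℕ<n i')
    overshoot-eq : overshoot a ≡ overshoot b
    overshoot-eq = trans (≡-sym (FinP.toℕ-fromℕ< _)) (trans (cong toℕ same) (FinP.toℕ-fromℕ< _))
    Ya<Yb : Y (match a) < Y (match b)
    Ya<Yb = +-cancelˡ-< (overshoot a) (Y (match a)) (Y (match b))
      (subst (λ o → overshoot a + Y (match a) < o + Y (match b)) (≡-sym overshoot-eq)
        (subst₂ _<_ (X≡overshoot+Y a) (X≡overshoot+Y b) (step-< sX a b i<i' b≤k)))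
    match< : match a < match b
    match< with match a <? match b
    ... | yes p = p
    ... | no p = ⊥-elim (<⇒≱ Ya<Yb (step-≤ sY (match b) (match a) (≮⇒≥ p) (lastBelow-≤ k (X a))))
    blocks : X b + Y (match a) ≡ Y (match b) + X a
    blocks = begin
      X b + Y (match a)                         ≡⟨ cong (_+ Y (match a)) (X≡overshoot+Y b) ⟩
      overshoot b + Y (match b) + Y (match a)   ≡⟨ cong (λ o → o + Y (match b) + Y (match a)) (≡-sym overshoot-eq) ⟩
      overshoot a + Y (match b) + Y (match a)   ≡⟨ cong (_+ Y (match a)) (+-comm (overshoot a) _) ⟩
      Y (match b) + overshoot a + Y (match a)   ≡⟨ +-assoc (Y (match b)) _ _ ⟩
      Y (match b) + (overshoot a + Y (match a)) ≡⟨ cong (Y (match b) +_) (≡-sym (X≡overshoot+Y a)) ⟩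
      Y (match b) + X a                         ∎
      where open ≡-Reasoning

equal-blocks : ∀ k .{{_ : ℕ.NonZero k}} {X Y} → StepSeq k X → StepSeq k Y → EqualBlocks k X Y
equal-blocks k {X} {Y} sX sY with X k ≤? Y k
... | yes Xk≤Yk = EqualBlocksBelow.equal-blocks-below k X Y sX sY Xk≤Yk
... | no Xk≰Yk = EqualBlocks-sym {X = X} {Y} (EqualBlocksBelow.equal-blocks-below k Y X sY sX (<⇒≤ (≰⇒> Xk≰Yk)))

module Enumeration {n : ℕ} (A : VSet n) where

  private
    outside? : (S : VSet n) → Dec (∃ λ v → (A ∖ S) v ≡ true)
    outside? S = FinP.any? (λ v → (A ∖ S) v BoolP.≟ true)

  -- a vertex of A outside S as a singleton, or ∅ if S already covers A
  newVertex : VSet n → VSet n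
  newVertex S with outside? S
  ... | yes (a , _) = ⟦ a ⟧
  ... | no _ = ∅

  newVertex-⊆ : ∀ S → newVertex S ⊆ A
  newVertex-⊆ S v v∈ with outside? S
  ... | yes (a , a∈A∖S) = subst (_∈ A) (≡-sym (∈⟦⟧ v∈)) (∧-true-l (A a) a∈A∖S)

  newVertex-new : ∀ S → 1 ≤ ∣ A ∖ S ∣ → ∃ λ a → a ∉ S × newVertex S ≐ ⟦ a ⟧
  newVertex-new S h with outside? S
  ... | yes (a , a∈A∖S) = a , ∧-not-r (A a) a∈A∖S , (λ _ → refl)
  ... | no none = ⊥-elim (none (nonempty (A ∖ S) h))

  prefix : ℕ → VSet n
  prefix zero = ∅
  prefix (suc i) = prefix i ∪ newVertex (prefix i)

  prefix-⊆ : ∀ i → prefix i ⊆ A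
  prefix-⊆ zero v ()
  prefix-⊆ (suc i) v v∈ with ∪-∈ {A = prefix i} {B = newVertex (prefix i)} v∈
  ... | inj₁ v∈prefix = prefix-⊆ i v v∈prefix
  ... | inj₂ v∈new = newVertex-⊆ (prefix i) v v∈new

  prefix-mono : ∀ i j → i ≤ j → prefix i ⊆ prefix j
  prefix-mono i j i≤j with m≤n⇒m<n∨m≡n i≤j
  ... | inj₂ refl = λ v h → h
  prefix-mono i (suc j) _ | inj₁ (s≤s i≤j) = λ v h → ∈∪ˡ {A = prefix j} {B = newVertex (prefix j)} (prefix-mono i j i≤j v h)

  prefix-room : ∀ i → ∣ prefix i ∣ < ∣ A ∣ → 1 ≤ ∣ A ∖ prefix i ∣
  prefix-room i small = +-cancelˡ-≤ ∣ prefix i ∣ 1 _ (begin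
    ∣ prefix i ∣ + 1                            ≡⟨ +-comm _ 1 ⟩
    suc ∣ prefix i ∣                            ≤⟨ small ⟩
    ∣ A ∣                                       ≡⟨ W-split _ A (prefix i) ⟩
    ∣ A ∩ prefix i ∣ + ∣ A ∖ prefix i ∣         ≤⟨ +-monoˡ-≤ _ (W-mono _ (λ v → ∧-true-r (A v))) ⟩
    ∣ prefix i ∣ + ∣ A ∖ prefix i ∣             ∎)
    where open ≤-Reasoning

  prefix-step : ∀ i → ∣ prefix i ∣ < ∣ A ∣ →
                ∃ λ a → a ∉ prefix i × prefix (suc i) ≐ prefix i ∪ ⟦ a ⟧
  prefix-step i small with newVertex-new (prefix i) (prefix-room i small)
  ... | a , a∉ , new≐a = a , a∉ , (λ v → cong (prefix i v ∨_) (new≐a v))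

  W-prefix-step : ∀ w i → ∣ prefix i ∣ < ∣ A ∣ →
    ∃ λ a → a ∈ prefix (suc i) × a ∉ prefix i × W w (prefix (suc i)) ≡ W w (prefix i) + w a
  W-prefix-step w i small with prefix-step i small
  ... | a , a∉ , step = a , a∈ , a∉ , (begin
    W w (prefix (suc i))         ≡⟨ W-cong w step ⟩
    W w (prefix i ∪ ⟦ a ⟧)       ≡⟨ W-∪ w (prefix i) ⟦ a ⟧ disjoint ⟩
    W w (prefix i) + W w ⟦ a ⟧   ≡⟨ cong (W w (prefix i) +_) (W-⟦⟧ w a) ⟩
    W w (prefix i) + w a         ∎)
    where
    open ≡-Reasoning
    a∈ : a ∈ prefix (suc i)
    a∈ = trans (step a) (∈∪ʳ {A = prefix i} {B = ⟦ a ⟧} (==-refl a))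
    disjoint : Disjoint (prefix i) ⟦ a ⟧
    disjoint v v∈ = ≢⇒==-false {i = v} {j = a} λ { refl → true≢false (trans (≡-sym v∈) a∉) }

  ∣prefix∣ : ∀ i → i ≤ ∣ A ∣ → ∣ prefix i ∣ ≡ i
  prefix-short : ∀ i → i < ∣ A ∣ → ∣ prefix i ∣ < ∣ A ∣

  ∣prefix∣ zero _ = W-∅ {n} (λ _ → 1)
  ∣prefix∣ (suc i) i<∣A∣ =
    trans (proj₂ (proj₂ (proj₂ (W-prefix-step (λ _ → 1) i (prefix-short i i<∣A∣)))))
          (trans (cong (_+ 1) (∣prefix∣ i (<⇒≤ i<∣A∣))) (+-comm i 1))

  prefix-short i i<∣A∣ = subst (_< ∣ A ∣) (≡-sym (∣prefix∣ i (<⇒≤ i<∣A∣))) i<∣A∣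

  prefix-StepSeq : ∀ k (w : Fin n → ℕ) → (∀ v → 1 ≤ w v × w v ≤ k) → k ≤ ∣ A ∣ →
                   StepSeq k (λ i → W w (prefix i))
  prefix-StepSeq k w w∈[1,k] k≤∣A∣ = W-∅ w , steps
    where
    steps : ∀ i → i < k → W w (prefix i) < W w (prefix (suc i)) × W w (prefix (suc i)) ≤ W w (prefix i) + k
    steps i i<k with W-prefix-step w i (prefix-short i (<-≤-trans i<k k≤∣A∣))
    ... | a , _ , _ , step rewrite step = m<m+n _ (proj₁ (w∈[1,k] a)) , +-monoʳ-≤ _ (proj₂ (w∈[1,k] a))

  W-prefix-block : ∀ w i i' → i ≤ i' → W w (prefix i') ≡ W w (prefix i) + W w (prefix i' ∖ prefix i)
  W-prefix-block w i i' i≤i' = trans (W-split w (prefix i') (prefix i))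
    (cong (_+ W w (prefix i' ∖ prefix i)) (W-cong w inner))
    where
    inner : prefix i' ∩ prefix i ≐ prefix i
    inner v with prefix i v in eq
    ... | true rewrite prefix-mono i i' i≤i' v eq = refl
    ... | false = BoolP.∧-zeroʳ (prefix i' v)

-- Exchange lemma.  For weights in [1,k] and sets A, B with at least k elements,
-- some nonempty X ⊆ A with at most k elements has the same weight as some Y ⊆ B:
-- take equal blocks of the prefix weights of enumerations of A and B.

exchange-lemma : ∀ {n} k .{{_ : ℕ.NonZero k}} (w : Fin n → ℕ) → (∀ v → 1 ≤ w v × w v ≤ k) →
  (A B : VSet n) → k ≤ ∣ A ∣ → k ≤ ∣ B ∣ →
  ∃₂ λ X Y → X ⊆ A × Y ⊆ B × W w X ≡ W w Y × (∃ λ a → a ∈ X) × ∣ X ∣ ≤ k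
exchange-lemma {n} k w w∈[1,k] A B k≤∣A∣ k≤∣B∣ =
  from-blocks (equal-blocks k (EA.prefix-StepSeq k w w∈[1,k] k≤∣A∣) (EB.prefix-StepSeq k w w∈[1,k] k≤∣B∣))
  where
  module EA = Enumeration A
  module EB = Enumeration B
  from-blocks : EqualBlocks k (λ i → W w (EA.prefix i)) (λ j → W w (EB.prefix j)) →
    ∃₂ λ X Y → X ⊆ A × Y ⊆ B × W w X ≡ W w Y × (∃ λ a → a ∈ X) × ∣ X ∣ ≤ k
  from-blocks (i , i' , j , j' , i<i' , i'≤k , j<j' , j'≤k , blocks) =
    X , Y , X⊆A , Y⊆B , equal-weight , X-nonempty , ∣X∣≤k
    where
    X Y : VSet n
    X = EA.prefix i' ∖ EA.prefix i
    Y = EB.prefix j' ∖ EB.prefix j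
    X⊆A : X ⊆ A
    X⊆A v v∈X = EA.prefix-⊆ i' v (∧-true-l (EA.prefix i' v) v∈X)
    Y⊆B : Y ⊆ B
    Y⊆B v v∈Y = EB.prefix-⊆ j' v (∧-true-l (EB.prefix j' v) v∈Y)
    a b : ℕ
    a = W w (EA.prefix i)
    b = W w (EB.prefix j)
    equal-weight : W w X ≡ W w Y
    equal-weight = +-cancelˡ-≡ (a + b) (W w X) (W w Y) (begin
      a + b + W w X           ≡⟨ +-assoc a b (W w X) ⟩
      a + (b + W w X)         ≡⟨ cong (a +_) (+-comm b (W w X)) ⟩
      a + (W w X + b)         ≡⟨ ≡-sym (+-assoc a (W w X) b) ⟩
      a + W w X + b           ≡⟨ cong (_+ b) (≡-sym (EA.W-prefix-block w i i' (<⇒≤ i<i'))) ⟩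
      W w (EA.prefix i') + b  ≡⟨ blocks ⟩
      W w (EB.prefix j') + a  ≡⟨ cong (_+ a) (EB.W-prefix-block w j j' (<⇒≤ j<j')) ⟩
      b + W w Y + a           ≡⟨ +-comm (b + W w Y) a ⟩
      a + (b + W w Y)         ≡⟨ ≡-sym (+-assoc a b (W w Y)) ⟩
      a + b + W w Y           ∎)
      where open ≡-Reasoning
    -- the vertex added at step i lies in the block
    X-nonempty : ∃ λ v → v ∈ X
    X-nonempty with EA.W-prefix-step w i (EA.prefix-short i (<-≤-trans i<i' (≤-trans i'≤k k≤∣A∣)))
    ... | v , v∈next , v∉ , _ = v , ∈∖ {A = EA.prefix i'} {B = EA.prefix i} (EA.prefix-mono (suc i) i' i<i' v v∈next) v∉
    ∣X∣≤k : ∣ X ∣ ≤ k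
    ∣X∣≤k = begin
      ∣ X ∣             ≤⟨ W-mono _ (λ v → ∧-true-l (EA.prefix i' v)) ⟩
      ∣ EA.prefix i' ∣  ≡⟨ EA.∣prefix∣ i' (≤-trans i'≤k k≤∣A∣) ⟩
      i'                ≤⟨ i'≤k ⟩
      k                 ∎
      where open ≤-Reasoning

adj-≢ : ∀ {n} (G : Graph n) {u v} → Adj G u v → u ≢ v
adj-≢ G {u} u~v refl = true≢false (trans (≡-sym u~v) (irrefl G u))

Isolated : ∀ {n} → Graph n → Fin n → Set
Isolated G v = ∀ x → adj G v x ≡ false

isolated-∈ : ∀ {n} (G : Graph n) S v → Dominating G S → Isolated G v → v ∈ S
isolated-∈ G S v dom v-isolated with dom v
... | inj₁ v∈S = v∈S
... | inj₂ (u , _ , u~v) = ⊥-elim (true≢false (trans (≡-sym u~v) (trans (sym G u v) (v-isolated u))))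

module StableClass {n : ℕ} (G : Graph n) (P : VSet n) (stableP : StableSetClass G P) where

  rep : Fin n
  rep = proj₁ (proj₁ stableP)

  rep∈P : rep ∈ P
  rep∈P = proj₂ (proj₂ (proj₁ stableP) rep) (λ _ _ _ → refl)

  independent : Independent G P
  independent = proj₂ (proj₂ stableP)

  neighbour-∉ : ∀ p x → p ∈ P → Adj G p x → x ∉ P
  neighbour-∉ p x p∈P p~x = ≢true λ x∈P → true≢false (trans (≡-sym p~x) (independent p x p∈P x∈P))

  same-neighbours : ∀ p p' x → p ∈ P → p' ∈ P → x ∉ P → adj G p x ≡ adj G p' x
  same-neighbours p p' x p∈P p'∈P x∉P = trans (≡-sym (twin p p∈P)) (twin p' p'∈P)
    where
    x≢ : ∀ y → y ∈ P → x ≢ y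
    x≢ y y∈P refl = true≢false (trans (≡-sym y∈P) x∉P)
    twin : ∀ y → y ∈ P → adj G rep x ≡ adj G y x
    twin y y∈P = proj₁ (proj₂ (proj₁ stableP) y) y∈P x (x≢ rep rep∈P) (x≢ y y∈P)

  common-neighbour : ∀ p p' x → p ∈ P → p' ∈ P → Adj G x p → Adj G x p'
  common-neighbour p p' x p∈P p'∈P x~p =
    trans (sym G x p') (trans (same-neighbours p' p x p'∈P p∈P x∉P) (trans (sym G p x) x~p))
    where
    x∉P : x ∉ P
    x∉P = neighbour-∉ p x p∈P (trans (sym G p x) x~p)

  -- if S contains two vertices p₁ ≠ p₂ of P and a neighbour u of p₁, then p₁ is
  -- redundant in S: u dominates p₁, and p₂ dominates every neighbour of p₁
  redundant : ∀ S p₁ p₂ u → p₁ ∈ P → p₂ ∈ P → p₁ ∈ S → p₂ ∈ S → p₁ ≢ p₂ →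
              u ∈ S → Adj G u p₁ → ¬ IsMDS G S
  redundant S p₁ p₂ u p₁∈P p₂∈P p₁∈S p₂∈S p₁≢p₂ u∈S u~p₁ (dom , minimal) =
    ==-false⇒≢ {i = p₁} {j = p₁}
      (proj₂ (∖-∈ {A = S} {B = ⟦ p₁ ⟧} (minimal (S ∖ ⟦ p₁ ⟧) (λ v → ∧-true-l (S v)) dom' p₁ p₁∈S))) refl
    where
    keep : ∀ {v} → v ∈ S → v ≢ p₁ → v ∈ S ∖ ⟦ p₁ ⟧
    keep {v} v∈S v≢p₁ = ∈∖ {A = S} {B = ⟦ p₁ ⟧} v∈S (≢⇒==-false {i = v} {j = p₁} v≢p₁)
    dom' : Dominating G (S ∖ ⟦ p₁ ⟧)
    dom' v with p₁ FinP.≟ v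
    ... | yes refl = inj₂ (u , keep u∈S (adj-≢ G u~p₁) , u~p₁)
    ... | no p₁≢v with dom v
    ...   | inj₁ v∈S = inj₁ (keep v∈S (p₁≢v ∘ ≡-sym))
    ...   | inj₂ (x , x∈S , x~v) with p₁ FinP.≟ x
    ...     | no p₁≢x = inj₂ (x , keep x∈S (p₁≢x ∘ ≡-sym) , x~v)
    ...     | yes refl = inj₂ (p₂ , keep p₂∈S (p₁≢p₂ ∘ ≡-sym) ,
                 trans (≡-sym (same-neighbours p₁ p₂ v p₁∈P p₂∈P (neighbour-∉ p₁ v p₁∈P x~v))) x~v)

  -- an mds that misses a vertex p₀ of P contains at most one vertex of P:
  -- p₀ is dominated by some u ∉ P, which is then adjacent to all of P
  missing-vertex : ∀ S p₀ p₁ p₂ → p₀ ∈ P → p₀ ∉ S → p₁ ∈ P → p₂ ∈ P → p₁ ∈ S → p₂ ∈ S →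
                   p₁ ≢ p₂ → ¬ IsMDS G S
  missing-vertex S p₀ p₁ p₂ p₀∈P p₀∉S p₁∈P p₂∈P p₁∈S p₂∈S p₁≢p₂ mds with proj₁ mds p₀
  ... | inj₁ p₀∈S = true≢false (trans (≡-sym p₀∈S) p₀∉S)
  ... | inj₂ (u , u∈S , u~p₀) =
    redundant S p₁ p₂ u p₁∈P p₂∈P p₁∈S p₂∈S p₁≢p₂ u∈S (common-neighbour p₀ p₁ u p₀∈P p₁∈P u~p₀) mds

RoomyMds : ∀ {n} → Graph n → VSet n → ℕ → Set
RoomyMds G P k = ∃ λ D → IsMDS G D × P ⊆ D × k ≤ ∣ ∁ D ∣

MdsWeighting : ∀ {n} → Graph n → (Fin n → ℕ) → ℕ → Set
MdsWeighting {n} G w t = ∀ (D : VSet n) → (IsMDS G D → W w D ≡ t) × (W w D ≡ t → IsMDS G D)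

module Weighted {n : ℕ} (G : Graph n) (w : Fin n → ℕ) (t : ℕ) (char : MdsWeighting G w t) where

  mds-weight : ∀ D → IsMDS G D → W w D ≡ t
  mds-weight D = proj₁ (char D)

  weight-mds : ∀ D → W w D ≡ t → IsMDS G D
  weight-mds D = proj₂ (char D)

  exchange-mds : ∀ D X Y → IsMDS G D → X ⊆ D → Disjoint Y D → W w X ≡ W w Y → IsMDS G (D ∖ X ∪ Y)
  exchange-mds D X Y mdsD X⊆D disj wX≡wY = weight-mds (D ∖ X ∪ Y) (+-cancelʳ-≡ (W w Y) _ _ (begin
    W w (D ∖ X ∪ Y) + W w Y   ≡⟨ cong (W w (D ∖ X ∪ Y) +_) (≡-sym wX≡wY) ⟩
    W w (D ∖ X ∪ Y) + W w X   ≡⟨ W-exchange w D X Y X⊆D disj ⟩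
    W w D + W w Y             ≡⟨ cong (_+ W w Y) (mds-weight D mdsD) ⟩
    t + W w Y                 ∎))
    where open ≡-Reasoning

  record Exchanged (k : ℕ) (P : VSet n) : Set where
    field
      S X : VSet n
      S-mds : IsMDS G S
      ∣X∣≤k : ∣ X ∣ ≤ k
      kept : ∀ v → v ∈ P ∖ X → v ∈ S
      missed : Fin n
      missed∈P : missed ∈ P
      missed∉S : missed ∉ S

  -- If P ⊆ D for an mds D, and both P and the complement of D have at least k
  -- vertices, the exchange lemma yields such an S = (D ∖ X) ∪ Y with Y outside D.
  exchange-out : ∀ k .{{_ : ℕ.NonZero k}} → (∀ v → 1 ≤ w v × w v ≤ k) →
    ∀ P → k ≤ ∣ P ∣ → RoomyMds G P k → Exchanged k P
  exchange-out k w∈[1,k] P k≤∣P∣ (D , mdsD , P⊆D , k≤∣∁D∣) =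
    from-exchange (exchange-lemma k w w∈[1,k] P (∁ D) k≤∣P∣ k≤∣∁D∣)
    where
    from-exchange : (∃₂ λ X Y → X ⊆ P × Y ⊆ ∁ D × W w X ≡ W w Y × (∃ λ a → a ∈ X) × ∣ X ∣ ≤ k) →
                    Exchanged k P
    from-exchange (X , Y , X⊆P , Y⊆∁D , wX≡wY , (p₀ , p₀∈X) , ∣X∣≤k) = record
      { S = D ∖ X ∪ Y
      ; X = X
      ; S-mds = exchange-mds D X Y mdsD X⊆D Y∩D=∅ wX≡wY
      ; ∣X∣≤k = ∣X∣≤k
      ; kept = kept
      ; missed = p₀
      ; missed∈P = X⊆P p₀ p₀∈X
      ; missed∉S = ∉-exchanged {D = D} {X} {Y} p₀∈X
          (≢true (λ p₀∈Y → true≢false (trans (≡-sym (X⊆D p₀ p₀∈X)) (Y∩D=∅ p₀ p₀∈Y))))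
      }
      where
      X⊆D : X ⊆ D
      X⊆D v v∈X = P⊆D v (X⊆P v v∈X)
      Y∩D=∅ : Disjoint Y D
      Y∩D=∅ v v∈Y = ∁-disjoint D v (Y⊆∁D v v∈Y)
      kept : ∀ v → v ∈ P ∖ X → v ∈ D ∖ X ∪ Y
      kept v v∈P∖X = ∈∪ˡ {A = D ∖ X} {B = Y}
        (∈∖ {A = D} {B = X} (P⊆D v (proj₁ (∖-∈ {A = P} {B = X} v∈P∖X))) (proj₂ (∖-∈ {A = P} {B = X} v∈P∖X)))

  -- no mds containing a stable set class P with |P| ≥ k + 2 leaves k vertices
  -- outside: in the exchanged mds S, the two remaining vertices of P ∖ X make
  -- the missing vertex of P impossible
  crowded-class : ∀ k .{{_ : ℕ.NonZero k}} → (∀ v → 1 ≤ w v × w v ≤ k) →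
    ∀ P → StableSetClass G P → k + 2 ≤ ∣ P ∣ → RoomyMds G P k → ⊥
  crowded-class k w∈[1,k] P stableP k+2≤∣P∣ roomy = two-left (two-elements (P ∖ X) (∣∣-∖-≥ P X k 2 k+2≤∣P∣ ∣X∣≤k))
    where
    open Exchanged (exchange-out k w∈[1,k] P (≤-trans (m≤m+n k 2) k+2≤∣P∣) roomy)
    two-left : (∃₂ λ p₁ p₂ → p₁ ∈ P ∖ X × p₂ ∈ P ∖ X × p₁ ≢ p₂) → ⊥
    two-left (p₁ , p₂ , p₁∈ , p₂∈ , p₁≢p₂) =
      StableClass.missing-vertex G P stableP S missed p₁ p₂ missed∈P missed∉S
        (∧-true-l (P p₁) p₁∈) (∧-true-l (P p₂) p₂∈) (kept p₁ p₁∈) (kept p₂ p₂∈) p₁≢p₂ S-mds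

  -- no mds containing a set P of at least k isolated vertices leaves k vertices
  -- outside: the exchanged mds misses an isolated vertex
  isolated-class : ∀ k .{{_ : ℕ.NonZero k}} → (∀ v → 1 ≤ w v × w v ≤ k) →
    ∀ P → (∀ p → p ∈ P → Isolated G p) → k ≤ ∣ P ∣ → RoomyMds G P k → ⊥
  isolated-class k w∈[1,k] P P-isolated k≤∣P∣ roomy =
    true≢false (trans (≡-sym (isolated-∈ G S missed (proj₁ S-mds) (P-isolated missed missed∈P))) missed∉S)
    where
    open Exchanged (exchange-out k w∈[1,k] P k≤∣P∣ roomy)

  -- If p ∈ P has a neighbour x, the maximal independent set D ⊇ P leaves at
  -- least k vertices outside: a maximal independent set E ∋ x avoids P, so
  -- w(D) = w(E) = t gives k² ≤ |P| ≤ w(P) ≤ w(E ∖ D) ≤ k |E ∖ D|.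
  room-beside-neighbour : ∀ k .{{_ : ℕ.NonZero k}} → (∀ v → 1 ≤ w v × w v ≤ k) →
    ∀ P → StableSetClass G P → k * k ≤ ∣ P ∣ → ∀ p x → p ∈ P → Adj G p x → RoomyMds G P k
  room-beside-neighbour k w∈[1,k] P stableP k²≤∣P∣ p x p∈P p~x =
    D , mis-mds G P independent , mis-⊇ G P , *-cancelˡ-≤ k (begin
      k * k          ≤⟨ k²≤∣P∣ ⟩
      ∣ P ∣          ≤⟨ ∣∣≤W w (proj₁ ∘ w∈[1,k]) P ⟩
      W w P          ≤⟨ wP≤wE∖D ⟩
      W w (E ∖ D)    ≤⟨ W≤k*∣∣ w k (proj₂ ∘ w∈[1,k]) (E ∖ D) ⟩
      k * ∣ E ∖ D ∣  ≤⟨ *-monoʳ-≤ k (W-mono _ (λ v v∈ → ∈∁ {A = D} (∧-not-r (E v) v∈))) ⟩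
      k * ∣ ∁ D ∣    ∎)
    where
    open ≤-Reasoning
    open StableClass G P stableP
    D E : VSet n
    D = mis G P
    E = mis G ⟦ x ⟧
    ⟦x⟧-independent : Independent G ⟦ x ⟧
    ⟦x⟧-independent u v u∈ v∈ rewrite ∈⟦⟧ {u = u} u∈ | ∈⟦⟧ {u = v} v∈ = irrefl G x
    x∈E : x ∈ E
    x∈E = mis-⊇ G ⟦ x ⟧ x (==-refl x)
    E∩P=∅ : Disjoint E P
    E∩P=∅ v v∈E = ≢true λ v∈P → true≢false (trans (≡-sym (common-neighbour p v x p∈P v∈P (trans (sym G x p) p~x)))
                                                   (mis-independent G ⟦ x ⟧ ⟦x⟧-independent x v x∈E v∈E))
    D∩P≐P : D ∩ P ≐ P
    D∩P≐P v with P v in eq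
    ... | true rewrite mis-⊇ G P v eq = refl
    ... | false = BoolP.∧-zeroʳ (D v)
    E∩D⊆D∖P : E ∩ D ⊆ D ∖ P
    E∩D⊆D∖P v v∈ = ∈∖ {A = D} {B = P} (∧-true-r (E v) v∈) (E∩P=∅ v (∧-true-l (E v) v∈))
    wP≤wE∖D : W w P ≤ W w (E ∖ D)
    wP≤wE∖D = +-cancelʳ-≤ (W w (D ∖ P)) _ _ (begin
      W w P + W w (D ∖ P)          ≡⟨ cong (_+ W w (D ∖ P)) (≡-sym (W-cong w D∩P≐P)) ⟩
      W w (D ∩ P) + W w (D ∖ P)    ≡⟨ ≡-sym (W-split w D P) ⟩
      W w D                        ≡⟨ mds-weight D (mis-mds G P independent) ⟩
      t                            ≡⟨ ≡-sym (mds-weight E (mis-mds G ⟦ x ⟧ ⟦x⟧-independent)) ⟩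
      W w E                        ≡⟨ W-split w E D ⟩
      W w (E ∩ D) + W w (E ∖ D)    ≤⟨ +-monoˡ-≤ _ (W-mono w E∩D⊆D∖P) ⟩
      W w (D ∖ P) + W w (E ∖ D)    ≡⟨ +-comm _ (W w (E ∖ D)) ⟩
      W w (E ∖ D) + W w (D ∖ P)    ∎)

module _ {n : ℕ} (G : Graph n) where

  twins-sym : ∀ {a v} → Twins G a v → Twins G v a
  twins-sym tw u u≢v u≢a = ≡-sym (tw u u≢a u≢v)

  isolated-twins : ∀ {a v} → Isolated G a → Isolated G v → Twins G a v
  isolated-twins iso-a iso-v x _ _ = trans (iso-a x) (≡-sym (iso-v x))

  twin-isolated : ∀ {a v} → Twins G a v → Isolated G a → Isolated G v
  twin-isolated {a} {v} tw iso-a x with a FinP.≟ x | v FinP.≟ x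
  ... | yes refl | _ = trans (sym G v a) (iso-a v)
  ... | no _ | yes refl = irrefl G v
  ... | no a≢x | no v≢x = trans (≡-sym (tw x (a≢x ∘ ≡-sym) (v≢x ∘ ≡-sym))) (iso-a x)

  isolated-twin-class : ∀ C → TwinClass G C → ∀ c → c ∈ C → Isolated G c →
                        ∀ v → (v ∈ C → Isolated G v) × (Isolated G v → v ∈ C)
  isolated-twin-class C (r , class) c c∈C iso-c v =
    (λ v∈C → twin-isolated (proj₁ (class v) v∈C) iso-r) ,
    (λ iso-v → proj₂ (class v) (isolated-twins iso-r iso-v))
    where
    iso-r : Isolated G r
    iso-r = twin-isolated (twins-sym (proj₁ (class c) c∈C)) iso-c

  isolated-twin-classes-equal : ∀ C C' → TwinClass G C → TwinClass G C' → ∀ c c' → c ∈ C → c' ∈ C' →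
                                Isolated G c → Isolated G c' → C ≐ C'
  isolated-twin-classes-equal C C' tc tc' c c' c∈C c'∈C' iso-c iso-c' = ⊆-antisym
    (λ v v∈C → proj₂ (isolated-twin-class C' tc' c' c'∈C' iso-c' v) (proj₁ (isolated-twin-class C tc c c∈C iso-c v) v∈C))
    (λ v v∈C' → proj₂ (isolated-twin-class C tc c c∈C iso-c v) (proj₁ (isolated-twin-class C' tc' c' c'∈C' iso-c' v) v∈C'))

KminusMatching-far : ∀ m (i j : Fin (2 * m)) → toℕ i / 2 ≢ toℕ j / 2 → KminusMatching m i j ≡ true
KminusMatching-far m i j far =
  cong₂ (λ a b → not a ∧ not b) (≢⇒==-false {i = i} {j = j} (far ∘ cong (λ l → toℕ l / 2)))
                                (dec-false ((toℕ i / 2) ℕ.≟ (toℕ j / 2)) far)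

KminusMatching-near : ∀ m (i j : Fin (2 * m)) → toℕ i / 2 ≡ toℕ j / 2 → KminusMatching m i j ≡ false
KminusMatching-near m i j near =
  trans (cong (λ d → not (i == j) ∧ not d) (dec-true ((toℕ i / 2) ℕ.≟ (toℕ j / 2)) near)) (BoolP.∧-zeroʳ _)

module FirstPair (m : ℕ) (2≤m : 2 ≤ m) where

  index : ∀ l → l < 2 * m → Fin (2 * m)
  index l l<2m = F.fromℕ< l<2m

  3≤2m : 3 ≤ 2 * m
  3≤2m = ≤-trans (s≤s (s≤s (s≤s z≤n))) (*-monoʳ-≤ 2 2≤m)

  first second third : Fin (2 * m)
  first = index 0 (≤-trans (s≤s z≤n) 3≤2m)
  second = index 1 (≤-trans (s≤s (s≤s z≤n)) 3≤2m)
  third = index 2 3≤2m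

  toℕ-first : toℕ first ≡ 0
  toℕ-first = FinP.toℕ-fromℕ< (≤-trans (s≤s z≤n) 3≤2m)

  toℕ-second : toℕ second ≡ 1
  toℕ-second = FinP.toℕ-fromℕ< (≤-trans (s≤s (s≤s z≤n)) 3≤2m)

  toℕ-third : toℕ third ≡ 2
  toℕ-third = FinP.toℕ-fromℕ< 3≤2m

  first-adjacent : ∀ j → j ≡ first ⊎ j ≡ second ⊎ KminusMatching m first j ≡ true
  first-adjacent j = classify (toℕ j) refl
    where
    classify : ∀ t → toℕ j ≡ t → j ≡ first ⊎ j ≡ second ⊎ KminusMatching m first j ≡ true
    classify zero eq = inj₁ (FinP.toℕ-injective (trans eq (≡-sym toℕ-first)))
    classify (suc zero) eq = inj₂ (inj₁ (FinP.toℕ-injective (trans eq (≡-sym toℕ-second))))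
    classify (suc (suc l)) eq = inj₂ (inj₂ (KminusMatching-far m first j far))
      where
      far : toℕ first / 2 ≢ toℕ j / 2
      far e = <⇒≱ (m/n≡0⇒m<n {toℕ j} {2} (trans (≡-sym e) (cong (_/ 2) toℕ-first)))
                  (subst (2 ≤_) (≡-sym eq) (s≤s (s≤s z≤n)))

  first-third : KminusMatching m first third ≡ true
  first-third = KminusMatching-far m first third λ e →
    0≢1 (trans (cong (_/ 2) (≡-sym toℕ-first)) (trans e (cong (_/ 2) toℕ-third)))
    where
    0≢1 : 0 ≢ 1
    0≢1 ()

-- Hubs.  Every pseudo class that is
-- not the class of isolated vertices has a hub.

module _ {n : ℕ} (G : Graph n) where

  Hub : VSet n → Fin n → Set
  Hub Q z = (∃ λ y → Adj G z y) × ∃ λ z' → ∀ u → u ∈ Q → u ≡ z ⊎ u ≡ z' ⊎ Adj G z u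

  -- in a copy of K_{2m} − m e, the vertex of index 0
  stable-bundle-hub : ∀ Q → InducesKminusMatching G Q → ∃ (Hub Q)
  stable-bundle-hub Q (m , 2≤m , f , _ , _ , onto , f-adj) =
    f first , (f third , trans (f-adj first third) first-third) , f second , covered
    where
    open FirstPair m 2≤m
    covered : ∀ u → u ∈ Q → u ≡ f first ⊎ u ≡ f second ⊎ Adj G (f first) u
    covered u u∈Q with onto u u∈Q
    ... | i , refl with first-adjacent i
    ...   | inj₁ refl = inj₁ refl
    ...   | inj₂ (inj₁ refl) = inj₂ (inj₁ refl)
    ...   | inj₂ (inj₂ adjacent) = inj₂ (inj₂ (trans (f-adj first i) adjacent))

  -- in a clique bundle, any of its vertices
  clique-bundle-hub : ∀ Q → CliqueBundleCandidate G Q → ∃ (Hub Q)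
  clique-bundle-hub Q (clique , (u , v , u∈Q , v∈Q , not-twins)) =
    u , (v , proj₁ (clique u v u∈Q v∈Q u≢v)) , u , covered
    where
    u≢v : u ≢ v
    u≢v refl = not-twins (λ _ _ _ → refl)
    covered : ∀ x → x ∈ Q → x ≡ u ⊎ x ≡ u ⊎ Adj G u x
    covered x x∈Q with u FinP.≟ x
    ... | yes refl = inj₁ refl
    ... | no u≢x = inj₂ (inj₂ (proj₁ (clique u x u∈Q x∈Q u≢x)))

  -- in a twin class, any neighbour of its representative
  twin-class-hub : ∀ Q → (tc : TwinClass G Q) → ∀ z → Adj G (proj₁ tc) z → Hub Q z
  twin-class-hub Q (q , class) z q~z = (q , trans (sym G z q) q~z) , z , covered
    where
    covered : ∀ u → u ∈ Q → u ≡ z ⊎ u ≡ z ⊎ Adj G z u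
    covered u u∈Q with z FinP.≟ u | q FinP.≟ u
    ... | yes refl | _ = inj₁ refl
    ... | no _ | yes refl = inj₂ (inj₂ (trans (sym G z q) q~z))
    ... | no z≢u | no _ = inj₂ (inj₂ (trans (sym G z u)
            (trans (≡-sym (proj₁ (class u) u∈Q z (adj-≢ G q~z ∘ ≡-sym) z≢u)) q~z)))

  -- if the stable set class P consists of isolated vertices, every other pseudo
  -- class has a hub (a twin class without hub would be the isolated class P)
  pseudo-class-hub : ∀ P Q → StableSetClass G P → (∀ p → p ∈ P → Isolated G p) →
                     PseudoClass G Q → ¬ (P ≐ Q) → ∃ (Hub Q)
  pseudo-class-hub P Q stableP P-isolated (inj₁ ((induced , _) , _)) P≢Q = stable-bundle-hub Q induced
  pseudo-class-hub P Q stableP P-isolated (inj₂ (inj₁ (candidate , _))) P≢Q = clique-bundle-hub Q candidate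
  pseudo-class-hub P Q stableP P-isolated (inj₂ (inj₂ (twinClass@(q , class) , _))) P≢Q
    with FinP.any? (λ z → adj G q z BoolP.≟ true)
  ... | yes (z , q~z) = z , twin-class-hub Q twinClass z q~z
  ... | no no-neighbour = ⊥-elim (P≢Q (isolated-twin-classes-equal G P Q (proj₁ stableP) twinClass
          rep q rep∈P q∈Q (P-isolated rep rep∈P) q-isolated))
    where
    open StableClass G P stableP
    q∈Q : q ∈ Q
    q∈Q = proj₂ (class q) (λ _ _ _ → refl)
    q-isolated : Isolated G q
    q-isolated x = ≢true (λ q~x → no-neighbour (x , q~x))

k+2≤k*k : ∀ k → 2 ≤ k → k + 2 ≤ k * k
k+2≤k*k k 2≤k = ≤-trans (+-monoʳ-≤ k 2≤k) (subst (_≤ k * k) (cong (k +_) (+-identityʳ k)) (*-monoˡ-≤ k 2≤k))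

-- If P consists of isolated vertices and z is a hub of Q with k² ≤ |Q|, then the
-- maximal independent set D ⊇ P ∪ {z} avoids the neighbours of z, which include
-- a vertex y and all of Q but two vertices; so D leaves k vertices outside.
room-beside-hub : ∀ {n} (G : Graph n) k → 1 ≤ k → ∀ P Q z → (∀ p → p ∈ P → Isolated G p) →
                  Hub G Q z → k * k ≤ ∣ Q ∣ → RoomyMds G P k
room-beside-hub {n} G k 1≤k P Q z P-isolated ((y , z~y) , z' , covered) k²≤∣Q∣ =
  D , mis-mds G (P ∪ ⟦ z ⟧) independent , (λ v v∈P → mis-⊇ G _ v (∈∪ˡ {A = P} {B = ⟦ z ⟧} v∈P)) , room
  where
  independent : Independent G (P ∪ ⟦ z ⟧)
  independent u v u∈ v∈ with ∪⟦⟧-∈ {A = P} u∈ | ∪⟦⟧-∈ {A = P} v∈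
  ... | inj₁ u∈P | _ = P-isolated u u∈P v
  ... | inj₂ refl | inj₁ v∈P = trans (sym G z v) (P-isolated v v∈P z)
  ... | inj₂ refl | inj₂ refl = irrefl G z
  D : VSet n
  D = mis G (P ∪ ⟦ z ⟧)
  z∈D : z ∈ D
  z∈D = mis-⊇ G _ z (∈∪ʳ {A = P} {B = ⟦ z ⟧} (==-refl z))
  neighbour-∉D : ∀ u → Adj G z u → u ∉ D
  neighbour-∉D u z~u = ≢true λ u∈D → true≢false (trans (≡-sym z~u) (mis-independent G _ independent z u z∈D u∈D))
  Q′ : VSet n
  Q′ = Q ∖ ⟦ z ⟧ ∖ ⟦ z' ⟧
  Q′⊆∁D : Q′ ⊆ ∁ D
  Q′⊆∁D u u∈Q′ with ∖-∈ {A = Q ∖ ⟦ z ⟧} {B = ⟦ z' ⟧} u∈Q′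
  ... | u∈Q∖z , u≢z' with ∖-∈ {A = Q} {B = ⟦ z ⟧} u∈Q∖z
  ...   | u∈Q , u≢z with covered u u∈Q
  ...     | inj₁ refl = ⊥-elim (==-false⇒≢ {i = u} u≢z refl)
  ...     | inj₂ (inj₁ refl) = ⊥-elim (==-false⇒≢ {i = u} u≢z' refl)
  ...     | inj₂ (inj₂ z~u) = ∈∁ {A = D} (neighbour-∉D u z~u)
  room : k ≤ ∣ ∁ D ∣
  room with k ≤? 1
  ... | yes k≤1 = ≤-trans k≤1 (subst (_≤ ∣ ∁ D ∣) (∣∣-⟦⟧ y)
                    (W-mono (λ _ → 1) (λ v v∈ → subst (_∈ ∁ D) (≡-sym (∈⟦⟧ {u = v} v∈)) (∈∁ {A = D} (neighbour-∉D y z~y)))))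
  ... | no k≰1 = ≤-trans (∣∣-∖-≥ (Q ∖ ⟦ z ⟧) ⟦ z' ⟧ 1 k
                           (∣∣-∖-≥ Q ⟦ z ⟧ 1 (1 + k) k+2≤∣Q∣ (≤-reflexive (∣∣-⟦⟧ z))) (≤-reflexive (∣∣-⟦⟧ z')))
                         (W-mono _ Q′⊆∁D)
    where
    k+2≤∣Q∣ : 1 + (1 + k) ≤ ∣ Q ∣
    k+2≤∣Q∣ = subst (_≤ ∣ Q ∣) (+-comm k 2) (≤-trans (k+2≤k*k k (≰⇒> k≰1)) k²≤∣Q∣)

lookup-injective : ∀ {A : Set} {xs : List A} → Unique xs → ∀ i j → lookup xs i ≡ lookup xs j → i ≡ j
lookup-injective (_ ∷ _) F.zero F.zero _ = refl
lookup-injective {xs = _ ∷ xs} (x∉xs ∷ _) F.zero (F.suc j) e = ⊥-elim (All.lookup x∉xs (∈-lookup {xs = xs} j) e)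
lookup-injective {xs = _ ∷ xs} (x∉xs ∷ _) (F.suc i) F.zero e = ⊥-elim (All.lookup x∉xs (∈-lookup {xs = xs} i) (≡-sym e))
lookup-injective (_ ∷ u) (F.suc i) (F.suc j) e = cong F.suc (lookup-injective u i j e)

-- Fixed-point-free involutions.  The orbits {v, π v} are enumerated by their
-- smaller elements, giving g : Fin m → Fin 2 → Fin n with g l 1 = π (g l 0).

module Involution {n : ℕ} (π : Fin n → Fin n)
  (π-involutive : ∀ v → π (π v) ≡ v) (π-fixfree : ∀ v → π v ≢ v) where

  π-injective : ∀ u v → π u ≡ π v → u ≡ v
  π-injective u v e = trans (≡-sym (π-involutive u)) (trans (cong π e) (π-involutive v))

  smaller? : ∀ v → Dec (toℕ v < toℕ (π v))
  smaller? v = toℕ v <? toℕ (π v)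

  reps : List (Fin n)
  reps = filter smaller? (allFin n)

  m : ℕ
  m = length reps

  rep : Fin m → Fin n
  rep = lookup reps

  rep-smaller : ∀ l → toℕ (rep l) < toℕ (π (rep l))
  rep-smaller l = proj₂ (∈-filter⁻ smaller? {xs = allFin n} (∈-lookup {xs = reps} l))

  rep-injective : ∀ l l' → rep l ≡ rep l' → l ≡ l'
  rep-injective = lookup-injective (Unique.filter⁺ smaller? (Unique.allFin⁺ n))

  rep-onto : ∀ v → toℕ v < toℕ (π v) → ∃ λ l → rep l ≡ v
  rep-onto v v-smaller = Any.index v∈reps , ≡-sym (lookup-index v∈reps)
    where
    v∈reps = ∈-filter⁺ smaller? {xs = allFin n} (∈-allFin v) v-smaller

  smaller-partner : ∀ v → ¬ (toℕ v < toℕ (π v)) → toℕ (π v) < toℕ (π (π v))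
  smaller-partner v not-smaller = subst (λ u → toℕ (π v) < toℕ u) (≡-sym (π-involutive v))
    (≤∧≢⇒< (≮⇒≥ not-smaller) (π-fixfree v ∘ FinP.toℕ-injective))

  g : Fin m → Fin 2 → Fin n
  g l F.zero = rep l
  g l (F.suc F.zero) = π (rep l)

  flip : Fin 2 → Fin 2
  flip F.zero = F.suc F.zero
  flip (F.suc F.zero) = F.zero

  π-g : ∀ l b → π (g l b) ≡ g l (flip b)
  π-g l F.zero = refl
  π-g l (F.suc F.zero) = π-involutive (rep l)

  rep≢partner : ∀ l l' → rep l ≢ π (rep l')
  rep≢partner l l' e = <-asym l<l' l'<l
    where
    l<l' : toℕ (rep l) < toℕ (rep l')
    l<l' = subst (λ u → toℕ (rep l) < toℕ u) (trans (cong π e) (π-involutive (rep l'))) (rep-smaller l)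
    l'<l : toℕ (rep l') < toℕ (rep l)
    l'<l = subst (λ u → toℕ (rep l') < toℕ u) (≡-sym e) (rep-smaller l')

  g-injective : ∀ l b l' b' → g l b ≡ g l' b' → l ≡ l' × b ≡ b'
  g-injective l F.zero l' F.zero e = rep-injective l l' e , refl
  g-injective l F.zero l' (F.suc F.zero) e = ⊥-elim (rep≢partner l l' e)
  g-injective l (F.suc F.zero) l' F.zero e = ⊥-elim (rep≢partner l' l (≡-sym e))
  g-injective l (F.suc F.zero) l' (F.suc F.zero) e = rep-injective l l' (π-injective _ _ e) , refl

  g-onto : ∀ v → ∃₂ λ l b → g l b ≡ v
  g-onto v with smaller? v
  ... | yes v-smaller = let (l , e) = rep-onto v v-smaller in l , F.zero , e
  ... | no not-smaller = let (l , e) = rep-onto (π v) (smaller-partner v not-smaller)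
                         in l , F.suc F.zero , trans (cong π e) (π-involutive v)

  SameOrbit : Fin n → Fin n → Set
  SameOrbit u v = u ≡ v ⊎ v ≡ π u

  same-orbit⇒ : ∀ l b l' b' → SameOrbit (g l b) (g l' b') → l ≡ l'
  same-orbit⇒ l b l' b' (inj₁ e) = proj₁ (g-injective l b l' b' e)
  same-orbit⇒ l b l' b' (inj₂ e) = ≡-sym (proj₁ (g-injective l' b' l (flip b) (trans e (π-g l b))))

  same-orbit⇐ : ∀ l b b' → SameOrbit (g l b) (g l b')
  same-orbit⇐ l F.zero F.zero = inj₁ refl
  same-orbit⇐ l F.zero (F.suc F.zero) = inj₂ refl
  same-orbit⇐ l (F.suc F.zero) F.zero = inj₂ (≡-sym (π-involutive (rep l)))
  same-orbit⇐ l (F.suc F.zero) (F.suc F.zero) = inj₁ refl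

-- Indices of Fin (2 * m) as pairs: i corresponds to (l , b) with i = 2 l + b,
-- so that toℕ i / 2 = l.

module PairIndex (m : ℕ) where

  pair : Fin m → Fin 2 → Fin (2 * m)
  pair l b = F.cast (*-comm m 2) (F.combine l b)

  unpair : Fin (2 * m) → Fin m × Fin 2
  unpair i = F.remQuot 2 (F.cast (*-comm 2 m) i)

  pair-unpair : ∀ i → uncurry pair (unpair i) ≡ i
  pair-unpair i = trans (cong (F.cast (*-comm m 2)) (FinP.combine-remQuot {m} 2 (F.cast (*-comm 2 m) i)))
                        (FinP.cast-involutive (*-comm m 2) (*-comm 2 m) i)

  unpair-injective : ∀ i j → unpair i ≡ unpair j → i ≡ j
  unpair-injective i j e = trans (≡-sym (pair-unpair i)) (trans (cong (uncurry pair) e) (pair-unpair j))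

  unpair-pair : ∀ l b → unpair (pair l b) ≡ (l , b)
  unpair-pair l b = trans (cong (F.remQuot 2) (FinP.cast-involutive (*-comm 2 m) (*-comm m 2) (F.combine l b)))
                          (FinP.remQuot-combine l b)

  half-pair : ∀ l b → toℕ (pair l b) / 2 ≡ toℕ l
  half-pair l b = begin
    toℕ (pair l b) / 2             ≡⟨ cong (_/ 2) (trans (FinP.toℕ-cast _ (F.combine l b)) (FinP.toℕ-combine l b)) ⟩
    (2 * toℕ l + toℕ b) / 2        ≡⟨ +-distrib-/-∣ˡ (toℕ b) (m∣m*n (toℕ l)) ⟩
    2 * toℕ l / 2 + toℕ b / 2      ≡⟨ cong₂ _+_ (trans (cong (_/ 2) (*-comm 2 (toℕ l))) (m*n/n≡m (toℕ l) 2))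
                                                (m<n⇒m/n≡0 (FinP.toℕ<n b)) ⟩
    toℕ l + 0                      ≡⟨ +-identityʳ (toℕ l) ⟩
    toℕ l                          ∎
    where open ≡-Reasoning

  half : ∀ i → toℕ i / 2 ≡ toℕ (proj₁ (unpair i))
  half i = trans (cong (λ j → toℕ j / 2) (≡-sym (pair-unpair i))) (half-pair (proj₁ (unpair i)) (proj₂ (unpair i)))

matching-enumeration : ∀ {n} (π : Fin n → Fin n) → (∀ v → π (π v) ≡ v) → (∀ v → π v ≢ v) →
  Σ ℕ λ m → Σ (Fin (2 * m) → Fin n) λ f →
    Injective _≡_ _≡_ f × (∀ v → ∃ λ i → f i ≡ v) ×
    (∀ i j → toℕ i / 2 ≡ toℕ j / 2 → f i ≡ f j ⊎ f j ≡ π (f i)) ×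
    (∀ i j → f i ≡ f j ⊎ f j ≡ π (f i) → toℕ i / 2 ≡ toℕ j / 2)
matching-enumeration {n} π π-involutive π-fixfree =
  m , f , (λ {i} {j} → f-injective i j) , f-onto , same-half⇒same-orbit , same-orbit⇒same-half
  where
  open Involution π π-involutive π-fixfree
  open PairIndex m
  f : Fin (2 * m) → Fin n
  f i = uncurry g (unpair i)
  f-injective : ∀ i j → f i ≡ f j → i ≡ j
  f-injective i j e with g-injective _ _ _ _ e
  ... | l≡l' , b≡b' = unpair-injective i j (cong₂ _,_ l≡l' b≡b')
  f-onto : ∀ v → ∃ λ i → f i ≡ v
  f-onto v with g-onto v
  ... | l , b , e = pair l b , trans (cong (uncurry g) (unpair-pair l b)) e
  same-half⇒same-orbit : ∀ i j → toℕ i / 2 ≡ toℕ j / 2 → f i ≡ f j ⊎ f j ≡ π (f i)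
  same-half⇒same-orbit i j e =
    subst (λ l → SameOrbit (f i) (g l (proj₂ (unpair j)))) same-pair
          (same-orbit⇐ (proj₁ (unpair i)) (proj₂ (unpair i)) (proj₂ (unpair j)))
    where
    same-pair : proj₁ (unpair i) ≡ proj₁ (unpair j)
    same-pair = FinP.toℕ-injective (trans (≡-sym (half i)) (trans e (half j)))
  same-orbit⇒same-half : ∀ i j → f i ≡ f j ⊎ f j ≡ π (f i) → toℕ i / 2 ≡ toℕ j / 2
  same-orbit⇒same-half i j orbit =
    trans (half i) (trans (cong toℕ (same-orbit⇒ (proj₁ (unpair i)) (proj₂ (unpair i)) (proj₁ (unpair j)) (proj₂ (unpair j)) orbit)) (≡-sym (half j)))

-- Graphs whose mds are exactly the 2-element sets.  Then no vertex dominates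
-- alone, any two vertices dominate, and so every vertex v has exactly one
-- non-neighbour π v ≠ v: non-adjacency is a perfect matching.

module PairDomination {n : ℕ} (G : Graph n) (pairs : MdsWeighting G (λ _ → 1) 2) where

  pair-dominating : ∀ u v → u ≢ v → Dominating G (⟦ u ⟧ ∪ ⟦ v ⟧)
  pair-dominating u v u≢v = proj₁ (proj₂ (pairs (⟦ u ⟧ ∪ ⟦ v ⟧)) size-2)
    where
    disjoint : Disjoint ⟦ u ⟧ ⟦ v ⟧
    disjoint y y∈u = ≢⇒==-false {i = y} {j = v} (λ y≡v → u≢v (trans (≡-sym (∈⟦⟧ y∈u)) y≡v))
    size-2 : ∣ ⟦ u ⟧ ∪ ⟦ v ⟧ ∣ ≡ 2
    size-2 = trans (W-∪ _ ⟦ u ⟧ ⟦ v ⟧ disjoint) (cong₂ _+_ (∣∣-⟦⟧ u) (∣∣-⟦⟧ v))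

  -- a dominating singleton would be an mds of size 1
  singleton-not-dominating : ∀ v → ¬ Dominating G ⟦ v ⟧
  singleton-not-dominating v dom = 1≢2 (trans (≡-sym (∣∣-⟦⟧ v)) (proj₁ (pairs ⟦ v ⟧) mds))
    where
    1≢2 : 1 ≢ 2
    1≢2 ()
    mds : IsMDS G ⟦ v ⟧
    mds = independent-dominating⇒mds G ⟦ v ⟧
      (λ a b a∈ b∈ → subst₂ (λ a b → adj G a b ≡ false) (≡-sym (∈⟦⟧ a∈)) (≡-sym (∈⟦⟧ b∈)) (irrefl G v)) dom

  Partner : Fin n → Fin n → Set
  Partner v u = u ≢ v × adj G v u ≡ false

  partner-exists : ∀ v → ∃ (Partner v)
  partner-exists v with FinP.any? (λ u → ((u == v) ∨ adj G v u) BoolP.≟ false)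
  ... | yes (u , undominated) = u , ==-false⇒≢ (BoolP.∨-conicalˡ _ _ undominated) , BoolP.∨-conicalʳ _ _ undominated
  ... | no none = ⊥-elim (singleton-not-dominating v dom)
    where
    dom : Dominating G ⟦ v ⟧
    dom u with u FinP.≟ v
    ... | yes refl = inj₁ refl
    ... | no u≢v = inj₂ (v , ==-refl v , ≢false λ v≁u →
                     none (u , trans (cong (_∨ adj G v u) (≢⇒==-false {i = u} {j = v} u≢v)) v≁u))

  -- two partners u ≠ u' of v would form a pair not dominating v
  partner-unique : ∀ v u u' → Partner v u → Partner v u' → u ≡ u'
  partner-unique v u u' (u≢v , v≁u) (u'≢v , v≁u') with u FinP.≟ u'
  ... | yes u≡u' = u≡u'
  ... | no u≢u' = ⊥-elim (undominated (pair-dominating u u' u≢u' v))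
    where
    member : ∀ s → s ∈ ⟦ u ⟧ ∪ ⟦ u' ⟧ → s ≡ u ⊎ s ≡ u'
    member s s∈ with ∪-∈ {A = ⟦ u ⟧} {B = ⟦ u' ⟧} {v = s} s∈
    ... | inj₁ s∈u = inj₁ (∈⟦⟧ {u = s} s∈u)
    ... | inj₂ s∈u' = inj₂ (∈⟦⟧ {u = s} s∈u')
    partner-of-v : ∀ s → s ≡ u ⊎ s ≡ u' → s ≢ v × adj G s v ≡ false
    partner-of-v _ (inj₁ refl) = u≢v , trans (sym G u v) v≁u
    partner-of-v _ (inj₂ refl) = u'≢v , trans (sym G u' v) v≁u'
    undominated : ¬ DominatedBy G (⟦ u ⟧ ∪ ⟦ u' ⟧) v
    undominated (inj₁ v∈) = proj₁ (partner-of-v v (member v v∈)) refl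
    undominated (inj₂ (s , s∈ , s~v)) = true≢false (trans (≡-sym s~v) (proj₂ (partner-of-v s (member s s∈))))

  π : Fin n → Fin n
  π v = proj₁ (partner-exists v)

  π-partner : ∀ v → Partner v (π v)
  π-partner v = proj₂ (partner-exists v)

  π-involutive : ∀ v → π (π v) ≡ v
  π-involutive v = partner-unique (π v) (π (π v)) v (π-partner (π v))
    ((λ e → proj₁ (π-partner v) (≡-sym e)) , trans (sym G (π v) v) (proj₂ (π-partner v)))

  π-fixfree : ∀ v → π v ≢ v
  π-fixfree v = proj₁ (π-partner v)

  non-adjacent⇒orbit : ∀ u v → adj G u v ≡ false → u ≡ v ⊎ v ≡ π u
  non-adjacent⇒orbit u v u≁v with u FinP.≟ v
  ... | yes u≡v = inj₁ u≡v
  ... | no u≢v = inj₂ (partner-unique u v (π u) ((u≢v ∘ ≡-sym) , u≁v) (π-partner u))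

  orbit⇒non-adjacent : ∀ u v → u ≡ v ⊎ v ≡ π u → adj G u v ≡ false
  orbit⇒non-adjacent u _ (inj₁ refl) = irrefl G u
  orbit⇒non-adjacent u _ (inj₂ refl) = proj₂ (π-partner u)

  -- an enumeration of the orbits of π turns G into K_{2m} − m e, and an edge p x
  -- joins two different orbits, forcing m ≥ 2; so all of G is a stable set bundle
  whole-bundle : ∀ p x → Adj G p x → StableSetBundle G (λ _ → true)
  whole-bundle p x p~x = from-enumeration (matching-enumeration π π-involutive π-fixfree)
    where
    from-enumeration : (Σ ℕ λ m → Σ (Fin (2 * m) → Fin n) λ f →
      Injective _≡_ _≡_ f × (∀ v → ∃ λ i → f i ≡ v) ×
      (∀ i j → toℕ i / 2 ≡ toℕ j / 2 → f i ≡ f j ⊎ f j ≡ π (f i)) ×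
      (∀ i j → f i ≡ f j ⊎ f j ≡ π (f i) → toℕ i / 2 ≡ toℕ j / 2)) → StableSetBundle G (λ _ → true)
    from-enumeration (m , f , f-injective , f-onto , same-half⇒orbit , orbit⇒same-half) =
      ((m , 2≤m , f , f-injective , (λ _ → refl) , (λ v _ → f-onto v) , f-adj) , (λ _ _ _ _ _ ())) ,
      (λ _ _ _ v _ → refl)
      where
      f-adj : ∀ i j → adj G (f i) (f j) ≡ KminusMatching m i j
      f-adj i j with toℕ i / 2 ℕ.≟ toℕ j / 2
      ... | yes same = trans (orbit⇒non-adjacent (f i) (f j) (same-half⇒orbit i j same))
                             (≡-sym (KminusMatching-near m i j same))
      ... | no different = trans (≢false (different ∘ orbit⇒same-half i j ∘ non-adjacent⇒orbit (f i) (f j)))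
                                     (≡-sym (KminusMatching-far m i j different))
      half<m : ∀ i → toℕ i / 2 < m
      half<m i = m<n*o⇒m/o<n (subst (toℕ i <_) (*-comm 2 m) (FinP.toℕ<n i))
      first-half : m ≤ 1 → ∀ i → toℕ i / 2 ≡ 0
      first-half m≤1 i = n≤0⇒n≡0 (≤-pred (≤-trans (half<m i) m≤1))
      2≤m : 2 ≤ m
      2≤m with m ≤? 1
      ... | no m≰1 = ≰⇒> m≰1
      ... | yes m≤1 = ⊥-elim (true≢false (trans (≡-sym p~x) (subst₂ (λ a b → adj G a b ≡ false)
              (proj₂ (f-onto p)) (proj₂ (f-onto x))
              (orbit⇒non-adjacent _ _ (same-half⇒orbit (proj₁ (f-onto p)) (proj₁ (f-onto x))
                (trans (first-half m≤1 (proj₁ (f-onto p))) (≡-sym (first-half m≤1 (proj₁ (f-onto x))))))))))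

-- A stable set class is a pseudo class only as a twin class outside all bundles:
-- bundles that are not twin classes contain edges.
stable-pseudo-class : ∀ {n} (G : Graph n) P → StableSetClass G P → PseudoClass G P →
                      ∀ B → Bundle G B → ¬ (P ⊆ B)
stable-pseudo-class G P stableP (inj₁ (((m , 2≤m , f , _ , f∈P , _ , f-adj) , _) , _)) B _ _ =
  true≢false (trans (≡-sym (trans (f-adj first third) first-third)) (independent _ _ (f∈P first) (f∈P third)))
  where
  open FirstPair m 2≤m
  open StableClass G P stableP
stable-pseudo-class G P stableP (inj₂ (inj₁ ((clique , (u , v , u∈P , v∈P , not-twins)) , _))) B _ _ =
  true≢false (trans (≡-sym (proj₁ (clique u v u∈P v∈P u≢v))) (independent u v u∈P v∈P))
  where
  open StableClass G P stableP
  u≢v : u ≢ v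
  u≢v refl = not-twins (λ _ _ _ → refl)
stable-pseudo-class G P stableP (inj₂ (inj₂ (_ , in-no-bundle))) B bundle P⊆B = in-no-bundle B bundle P⊆B

-- With unit weights, if the stable set class P has a neighbour x then the mds
-- have size |P|: in the maximal independent set D ⊇ P, any vertex v ∉ P could be
-- exchanged for x, and x would make a vertex of P redundant.  So D = P.
unit-weight-target : ∀ {n} (G : Graph n) t → MdsWeighting G (λ _ → 1) t → ∀ P → StableSetClass G P →
                     ∀ p x → p ∈ P → Adj G p x → t ≡ ∣ P ∣
unit-weight-target {n} G t char P stableP p x p∈P p~x =
  trans (≡-sym (mds-weight D mdsD)) (W-cong _ D≐P)
  where
  open StableClass G P stableP
  open Weighted G (λ _ → 1) t char
  D : VSet n
  D = mis G P
  mdsD : IsMDS G D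
  mdsD = mis-mds G P independent
  x∉D : x ∉ D
  x∉D = ≢true λ x∈D → true≢false (trans (≡-sym p~x) (mis-independent G P independent p x (mis-⊇ G P p p∈P) x∈D))
  D⊆P : D ⊆ P
  D⊆P v v∈D with two-elements P (subst (2 ≤_) (card≡∣∣ P) (proj₁ (proj₂ stableP)))
  ... | p₁ , p₂ , p₁∈P , p₂∈P , p₁≢p₂ = ≢false λ v∉P →
    redundant S p₁ p₂ x p₁∈P p₂∈P (kept p₁ p₁∈P v∉P) (kept p₂ p₂∈P v∉P) p₁≢p₂
      (∈∪ʳ {A = D ∖ ⟦ v ⟧} {B = ⟦ x ⟧} (==-refl x)) (common-neighbour p p₁ x p∈P p₁∈P (trans (sym G x p) p~x))
      (exchange-mds D ⟦ v ⟧ ⟦ x ⟧ mdsD (λ u u∈ → subst (_∈ D) (≡-sym (∈⟦⟧ {u = u} u∈)) v∈D)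
        (λ u u∈ → subst (_∉ D) (≡-sym (∈⟦⟧ {u = u} u∈)) x∉D) (trans (∣∣-⟦⟧ v) (≡-sym (∣∣-⟦⟧ x))))
    where
    S : VSet n
    S = D ∖ ⟦ v ⟧ ∪ ⟦ x ⟧
    kept : ∀ q → q ∈ P → v ∉ P → q ∈ S
    kept q q∈P v∉P = ∈∪ˡ {A = D ∖ ⟦ v ⟧} {B = ⟦ x ⟧} (∈∖ {A = D} {B = ⟦ v ⟧} (mis-⊇ G P q q∈P)
      (≢⇒==-false {i = q} {j = v} λ { refl → true≢false (trans (≡-sym q∈P) v∉P) }))
  D≐P : D ≐ P
  D≐P = ⊆-antisym D⊆P (mis-⊇ G P)

-- k = 1 and |P| = 2 with an edge at P: the mds are exactly the pairs, so G is a
-- stable set bundle containing P, which is impossible for a pseudo class.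
unit-pair-case : ∀ {n} (G : Graph n) t → MdsWeighting G (λ _ → 1) t → ∀ P → StableSetClass G P →
                 PseudoClass G P → ∣ P ∣ ≡ 2 → ∀ p x → p ∈ P → Adj G p x → ⊥
unit-pair-case G t char P stableP pseudoP ∣P∣≡2 p x p∈P p~x =
  stable-pseudo-class G P stableP pseudoP (λ _ → true)
    (inj₁ (PairDomination.whole-bundle G pairs p x p~x)) (λ _ _ → refl)
  where
  pairs : MdsWeighting G (λ _ → 1) 2
  pairs = subst (MdsWeighting G (λ _ → 1)) (trans (unit-weight-target G t char P stableP p x p∈P p~x) ∣P∣≡2) char

-- Case 1: a vertex p of P has a neighbour x.  If |P| ≥ k + 2 the exchange
-- argument applies; otherwise k = 1 and |P| = 2, so all weights are 1.
neighbour-case : ∀ {n} (G : Graph n) k .{{_ : ℕ.NonZero k}} (w : Fin n → ℕ) t →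
  (∀ v → 1 ≤ w v × w v ≤ k) → MdsWeighting G w t → ∀ P → PseudoClass G P → StableSetClass G P →
  k * k ≤ ∣ P ∣ → ∀ p x → p ∈ P → Adj G p x → ⊥
neighbour-case G k w t w∈[1,k] char P pseudoP stableP k²≤∣P∣ p x p∈P p~x with k + 2 ≤? ∣ P ∣
... | yes P-large = crowded-class k w∈[1,k] P stableP P-large
                      (room-beside-neighbour k w∈[1,k] P stableP k²≤∣P∣ p x p∈P p~x)
  where open Weighted G w t char
... | no P-small = unit-pair-case G t unit-char P stableP pseudoP ∣P∣≡2 p x p∈P p~x
  where
  open Weighted G w t char
  k≡1 : k ≡ 1
  k≡1 with k ≤? 1
  ... | yes k≤1 = ≤-antisym k≤1 (ℕ.>-nonZero⁻¹ k)
  ... | no k≰1 = ⊥-elim (P-small (≤-trans (k+2≤k*k k (≰⇒> k≰1)) k²≤∣P∣))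
  ∣P∣≡2 : ∣ P ∣ ≡ 2
  ∣P∣≡2 = ≤-antisym (≤-pred (subst (λ j → ∣ P ∣ < j + 2) k≡1 (≰⇒> P-small)))
                    (subst (2 ≤_) (card≡∣∣ P) (proj₁ (proj₂ stableP)))
  w≡1 : ∀ v → w v ≡ 1
  w≡1 v = ≤-antisym (subst (w v ≤_) k≡1 (proj₂ (w∈[1,k] v))) (proj₁ (w∈[1,k] v))
  unit-char : MdsWeighting G (λ _ → 1) t
  unit-char D = (λ mds → trans (≡-sym (W-unit w w≡1 D)) (mds-weight D mds)) ,
                (λ ∣D∣≡t → weight-mds D (trans (W-unit w w≡1 D) ∣D∣≡t))

-- Case 2: P consists of isolated vertices.  Then Q has a hub, which makes room
-- for the exchange argument.
isolated-case : ∀ {n} (G : Graph n) k .{{_ : ℕ.NonZero k}} (w : Fin n → ℕ) t →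
  (∀ v → 1 ≤ w v × w v ≤ k) → MdsWeighting G w t →
  ∀ P Q → PseudoClass G Q → ¬ (P ≐ Q) → StableSetClass G P → (∀ p → p ∈ P → Isolated G p) →
  k * k ≤ ∣ P ∣ → k * k ≤ ∣ Q ∣ → ⊥
isolated-case G k w t w∈[1,k] char P Q pseudoQ P≢Q stableP P-isolated k²≤∣P∣ k²≤∣Q∣
  with pseudo-class-hub G P Q stableP P-isolated pseudoQ P≢Q
... | z , hub = isolated-class k w∈[1,k] P P-isolated (≤-trans k≤k*k k²≤∣P∣)
                  (room-beside-hub G k (ℕ.>-nonZero⁻¹ k) P Q z P-isolated hub k²≤∣Q∣)
  where
  open Weighted G w t char
  k≤k*k : k ≤ k * k
  k≤k*k = subst (_≤ k * k) (*-identityʳ k) (*-monoʳ-≤ k (ℕ.>-nonZero⁻¹ k))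

no-mds-weighting : ∀ {n} (G : Graph n) k .{{_ : ℕ.NonZero k}} (w : Fin n → ℕ) t →
  (∀ v → 1 ≤ w v × w v ≤ k) → MdsWeighting G w t →
  ∀ P Q → PseudoClass G P → PseudoClass G Q → ¬ (P ≐ Q) → StableSetClass G P →
  k * k ≤ ∣ P ∣ → k * k ≤ ∣ Q ∣ → ⊥
no-mds-weighting G k w t w∈[1,k] char P Q pseudoP pseudoQ P≢Q stableP k²≤∣P∣ k²≤∣Q∣
  with FinP.any? (λ p → FinP.any? (λ x → (P p ∧ adj G p x) BoolP.≟ true))
... | yes (p , x , p∈P∧p~x) =
  neighbour-case G k w t w∈[1,k] char P pseudoP stableP k²≤∣P∣ p x (∧-true-l (P p) p∈P∧p~x) (∧-true-r (P p) p∈P∧p~x)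
... | no no-edge =
  isolated-case G k w t w∈[1,k] char P Q pseudoQ P≢Q stableP P-isolated k²≤∣P∣ k²≤∣Q∣
  where
  P-isolated : ∀ p → p ∈ P → Isolated G p
  P-isolated p p∈P x = ≢true λ p~x → no-edge (p , x , trans (cong (_∧ adj G p x) p∈P) p~x)

lemma7p2 : (k : ℕ) → 1 ≤ k → ∀ {n} (G : Graph n) (P Q : VSet n) →
    PseudoClass G P → PseudoClass G Q → ¬ (P ≐ Q) →
    StableSetClass G P → k * k ≤ card P → k * k ≤ card Q →
    ¬ Equidominating G k
lemma7p2 k 1≤k G P Q pseudoP pseudoQ P≢Q stableP k²≤|P| k²≤|Q| (t , _ , w , w∈[1,k] , char) =
  no-mds-weighting G k {{ℕ.>-nonZero 1≤k}} w t w∈[1,k] char′ P Q pseudoP pseudoQ P≢Q stableP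
    (subst (k * k ≤_) (card≡∣∣ P) k²≤|P|) (subst (k * k ≤_) (card≡∣∣ Q) k²≤|Q|)
  where
  char′ : MdsWeighting G w t
  char′ D = (λ mds → trans (≡-sym (weight≡W w D)) (proj₁ (char D) mds)) ,
            (λ wD≡t → proj₂ (char D) (trans (weight≡W w D) wD≡t))
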